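{- Let $t\ge 3$ be an integer and let $W$ be a symmetric $(4t,4(t-1))$-weighing matrix whose diagonal $4\times 4$ blocks are all zero. Let $W'$ be the $8t\times 8t$ matrix obtained from $W$ by replacing each entry $0$ by $O_2$, each $1$ by $I_2$, and each $-1$ by $J_2-I_2$, and let $$M_0=I_{8t},\ M_1=I_{4t}\otimes(J_2-I_2),\ M_2=I_t\otimes\big((J_4-I_4)\otimes J_2\big),\ M_3=W',\ M_4=J_{8t}-M_0-M_1-M_2-M_3.$$ Let $V=\{1,\dots,8t\}$, $s_i=\{(x,y)\in V^2:(M_i)_{xy}=1\}$, and for $i\in\{3,4\}$ let $\Gamma_i$ be the graph with vertex set $V$ and edge set $s_2\cup s_i$. Then $\Gamma_3$ and $\Gamma_4$ are proper divisible design graphs belonging to $\mathcal{K}_2$ with parameters $(8t,\,4t+2,\,6,\,2t+2,\,4t,\,2)$.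
   Context: An $(n,k)$-weighing matrix is an $n\times n$ $\{0,1,-1\}$-matrix $W$ with $WW^T=kI_n$; $I_n,J_n,O_n$ are identity, all-ones and zero matrices; $\otimes$ is the Kronecker product. A regular graph of degree $k$ on $v$ vertices is a divisible design graph (DDG) with parameters $(v,k,\lambda_1,\lambda_2,m,n)$ if its vertex set can be partitioned into $m$ classes of size $n$ such that two distinct vertices in the same class have exactly $\lambda_1$ common neighbours and two vertices in different classes have exactly $\lambda_2$; it is proper if $m,n>1$ and $\lambda_1\ne\lambda_2$. Association schemes: a partition $S$ of $V^2$ containing the diagonal $\mathbf{1}_V$, closed under transposition, with intersection numbers $c_{rs}^t=|\{z:(x,z)\in r,(z,y)\in s\}|$ independent of $(x,y)\in t$; valency $n_r=|\{y:(x,y)\in r\}|$; a parabolic is an equivalence relation that is a union of elements of $S$; $\mathrm{rad}(s)$ is the largest relation $r$ with $rs=sr=s$. A scheme is Higmanian if $|S|=5$, all basis relations are symmetric, there exist $s_1,s_2\in S$ with $e_0=\mathbf{1}_V\cup s_1$, $e_1=\mathbf{1}_V\cup s_1\cup s_2$ parabolics, and $\mathrm{rad}(s)=\mathbf{1}_V$ for all $s\in S$ not contained in $e_1$. A standard ordering is $s_0=\mathbf{1}_V$, $s_1=e_0\setminus\mathbf{1}_V$, $s_2=e_1\setminus e_0$, remaining $s_3,s_4$ with $n_3\le n_4$. $\mathcal{K}_2$ is the class of graphs $(V,s_2\cup s_i)$, $i\in\{3,4\}$, arising from a Higmanian scheme with standard ordering satisfying $c_{33}^3=c_{33}^4$ and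 $\frac{n_2}{n_1+1}-\frac{2n_i}{n_{7-i}}=1$ (with $n_j=n_{s_j}$, $c_{jk}^l=c_{s_js_k}^{s_l}$). -}

module Defs where

open import Data.Nat as ℕ using (ℕ; zero; suc; _≡ᵇ_; _<?_; _≤_; _/_; _%_)
open import Data.Integer as ℤ using (ℤ; +_; -[1+_]; _-_; _*_)
import Data.Integer.Properties as ℤP
open import Data.Fin as Fin using (Fin; toℕ; fromℕ<)
open import Data.Fin.Patterns using (0F; 1F; 2F; 3F; 4F)
open import Data.Bool using (Bool; true; false; if_then_else_; _∧_; _∨_)
open import Data.List using (List; allFin; map; foldr)
open import Data.Product using (Σ; ∃; ∃₂; _×_; _,_)
open import Data.Sum using (_⊎_)
open import Relation.Binary.PropositionalEquality using (_≡_; _≢_)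
open import Relation.Binary.Structures using (IsEquivalence)
open import Relation.Nullary.Decidable using (⌊_⌋; yes; no)
open import Function.Bundles using (_⇔_)

sumℤ : (N : ℕ) → (Fin N → ℤ) → ℤ
sumℤ N f = foldr ℤ._+_ (+ 0) (map f (allFin N))

count : (N : ℕ) → (Fin N → Bool) → ℕ
count N P = foldr ℕ._+_ 0 (map (λ z → if P z then 1 else 0) (allFin N))

FMat : ℕ → Set
FMat n = Fin n → Fin n → ℤ

IsWeighing : (n k : ℕ) → FMat n → Set
IsWeighing n k W =
  (∀ i j → W i j ≡ + 0 ⊎ W i j ≡ + 1 ⊎ W i j ≡ -[1+ 0 ])
  × (∀ i j → sumℤ n (λ l → W i l * W j l)
              ≡ (if ⌊ i Fin.≟ j ⌋ then + k else + 0))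

IsSymmetricMat : (n : ℕ) → FMat n → Set
IsSymmetricMat n W = ∀ i j → W i j ≡ W j i

-- all diagonal 4×4 blocks are zero (indices i, j in the same block
-- iff ⌊i/4⌋ = ⌊j/4⌋, 0-based indexing)
ZeroDiag4Blocks : (n : ℕ) → FMat n → Set
ZeroDiag4Blocks n W = ∀ i j → toℕ i / 4 ≡ toℕ j / 4 → W i j ≡ + 0

-- Matrices with 0-based ℕ indices (only entries with indices < size
-- matter).  Kronecker product A ⊗ B with B of size q:
--   (A ⊗ B)[x,y] = A[x/q, y/q] * B[x%q, y%q].

Mat : Set
Mat = ℕ → ℕ → ℤ

Id : Mat
Id a b = if a ≡ᵇ b then + 1 else + 0

J : Mat
J a b = + 1

_-ᴹ_ : Mat → Mat → Mat
infixl 6 _-ᴹ_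
(A -ᴹ B) a b = A a b - B a b

kron : (q : ℕ) .{{_ : ℕ.NonZero q}} → Mat → Mat → Mat
kron q A B x y = A (x / q) (y / q) * B (x % q) (y % q)

extend : (n : ℕ) → FMat n → Mat
extend n W a b with a <? n | b <? n
... | yes p | yes q = W (fromℕ< p) (fromℕ< q)
... | _     | _     = + 0

block : ℤ → Mat
block (+ 0)      = λ _ _ → + 0
block (+ 1)      = Id
block -[1+ 0 ]   = J -ᴹ Id
block _          = λ _ _ → + 0

expand : (n : ℕ) → FMat n → Mat
expand n W x y = block (extend n W (x / 2) (y / 2)) (x % 2) (y % 2)

M : (t : ℕ) → FMat (4 ℕ.* t) → Fin 5 → Mat
M t W 0F = Id
M t W 1F = kron 2 Id (J -ᴹ Id)
M t W 2F = kron 8 Id (kron 2 (J -ᴹ Id) J)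
M t W 3F = expand (4 ℕ.* t) W
M t W 4F = J -ᴹ Id -ᴹ M t W 1F -ᴹ M t W 2F -ᴹ M t W 3F

Gamma : (t : ℕ) → FMat (4 ℕ.* t) → Fin 5 → Fin (8 ℕ.* t) → Fin (8 ℕ.* t) → Bool
Gamma t W i x y =
  ⌊ M t W 2F (toℕ x) (toℕ y) ℤ.≟ + 1 ⌋ ∨ ⌊ M t W i (toℕ x) (toℕ y) ℤ.≟ + 1 ⌋

degree : (N : ℕ) → (Fin N → Fin N → Bool) → Fin N → ℕ
degree N adj x = count N (adj x)

common : (N : ℕ) → (Fin N → Fin N → Bool) → Fin N → Fin N → ℕ
common N adj x y = count N (λ z → adj x z ∧ adj y z)

IsDDG : (N : ℕ) → (Fin N → Fin N → Bool) → (v k λ₁ λ₂ m n : ℕ) → Set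
IsDDG N adj v k λ₁ λ₂ m n =
  N ≡ v
  × (∀ x → degree N adj x ≡ k)
  × Σ (Fin N → Fin m) (λ cls →
        (∀ a → count N (λ x → ⌊ cls x Fin.≟ a ⌋) ≡ n)
      × (∀ x y → x ≢ y → cls x ≡ cls y → common N adj x y ≡ λ₁)
      × (∀ x y → cls x ≢ cls y → common N adj x y ≡ λ₂))

IsProperDDG : (N : ℕ) → (Fin N → Fin N → Bool) → (v k λ₁ λ₂ m n : ℕ) → Set
IsProperDDG N adj v k λ₁ λ₂ m n =
  IsDDG N adj v k λ₁ λ₂ m n × 1 ℕ.< m × 1 ℕ.< n × λ₁ ≢ λ₂

-- Association schemes, given as a colouring c of V² = Fin N × Fin N by
-- Fin d (the basis relations are s_a = {(x,y) : c x y ≡ a}).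

Rel₀ : ℕ → Set₁
Rel₀ N = Fin N → Fin N → Set

basisRel : {N d : ℕ} → (Fin N → Fin N → Fin d) → Fin d → Rel₀ N
basisRel c a x y = c x y ≡ a

_∘ᴿ_ : {N : ℕ} → Rel₀ N → Rel₀ N → Rel₀ N
(r ∘ᴿ s) x y = ∃ λ z → r x z × s z y

_≐_ : {N : ℕ} → Rel₀ N → Rel₀ N → Set
r ≐ s = ∀ x y → r x y ⇔ s x y

-- intersection number c_{ab}^{c(x,y)} computed at (x,y)
interNum : {N d : ℕ} → (Fin N → Fin N → Fin d) → Fin N → Fin N → Fin d → Fin d → ℕ
interNum {N} c x y a b = count N (λ z → ⌊ c x z Fin.≟ a ⌋ ∧ ⌊ c z y Fin.≟ b ⌋)

valencyAt : {N d : ℕ} → (Fin N → Fin N → Fin d) → Fin N → Fin d → ℕ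
valencyAt {N} c x a = count N (λ y → ⌊ c x y Fin.≟ a ⌋)

IsScheme : (N d : ℕ) → (Fin N → Fin N → Fin d) → Set
IsScheme N d c =
  -- every class is nonempty (so S has exactly d elements)
  (∀ a → ∃₂ λ x y → c x y ≡ a)
  × (Σ (Fin d) λ a → ∀ x y → (c x y ≡ a) ⇔ (x ≡ y))
  × (Σ (Fin d → Fin d) λ τ → ∀ x y → c y x ≡ τ (c x y))
  × (∀ a b x y x' y' → c x y ≡ c x' y' → interNum c x y a b ≡ interNum c x' y' a b)

-- rad(s) = 1_V : every relation r with rs = sr = s is contained in 1_V
-- (the largest such r always contains 1_V)
RadTrivial : (N : ℕ) → Rel₀ N → Set₁
RadTrivial N s = ∀ (r : Rel₀ N) → (r ∘ᴿ s) ≐ s → (s ∘ᴿ r) ≐ s → ∀ x y → r x y → x ≡ y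

-- A Higmanian scheme whose colour labels 0,…,4 form a standard ordering
IsStdHigmanian : (N : ℕ) → (Fin N → Fin N → Fin 5) → Set₁
IsStdHigmanian N c =
  IsScheme N 5 c
  × (∀ x y → c x y ≡ c y x)
  × (∀ x y → (c x y ≡ 0F) ⇔ (x ≡ y))
  × IsEquivalence (λ x y → c x y ≡ 0F ⊎ c x y ≡ 1F)
  × IsEquivalence (λ x y → c x y ≡ 0F ⊎ c x y ≡ 1F ⊎ c x y ≡ 2F)
  × RadTrivial N (basisRel c 3F)
  × RadTrivial N (basisRel c 4F)
  × (∀ x → valencyAt c x 3F ≤ valencyAt c x 4F)

-- class 𝒦₂ condition for i (with j = 7 - i):
-- c_{33}^3 = c_{33}^4 and n₂/(n₁+1) - 2 n_i / n_j = 1,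
-- the latter written with denominators cleared:
-- n₂ n_j = (n₁+1) n_j + 2 n_i (n₁+1)
K2Cond : (N : ℕ) → (Fin N → Fin N → Fin 5) → Fin 5 → Fin 5 → Set
K2Cond N c i j =
  (∀ x y x' y' → c x y ≡ 3F → c x' y' ≡ 4F →
     interNum c x y 3F 3F ≡ interNum c x' y' 3F 3F)
  × (∀ x → valencyAt c x 2F ℕ.* valencyAt c x j
           ≡ suc (valencyAt c x 1F) ℕ.* valencyAt c x j
             ℕ.+ 2 ℕ.* valencyAt c x i ℕ.* suc (valencyAt c x 1F))

InK2 : (N : ℕ) → (Fin N → Fin N → Bool) → Set₁
InK2 N adj = Σ (Fin N → Fin N → Fin 5) λ c →
  IsStdHigmanian N c
  × (  ((∀ x y → (adj x y ≡ true) ⇔ (c x y ≡ 2F ⊎ c x y ≡ 3F)) × K2Cond N c 3F 4F)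
     ⊎ ((∀ x y → (adj x y ≡ true) ⇔ (c x y ≡ 2F ⊎ c x y ≡ 4F)) × K2Cond N c 4F 3F))

-- Write t = 2 + u, and view vertex X as the pair (X / 2, X % 2) of a row index of W and a
-- parity. Each row of W has 4(t - 1) nonzero entries and none in its diagonal block, which
-- leaves exactly 4(t - 1) other positions; so all entries off the diagonal blocks are ±1, and
-- the colour of a pair of vertices (a, e), (b, g) depends only on the link of a and b (equal,
-- in one block, or in different blocks with the sign of W_ab) and on whether e = g.
-- To count the vertices z = (l, h) with prescribed colours c(x, z) and c(z, y), sort the
-- indices l by the links (a, l) and (l, b). Replacing h by 1 - h shows that each index only
-- sees these links up to a common change of sign, and the number of indices in each category
-- is an affine function of u that depends only on the link of a and b; for sign agreement
-- versus disagreement this is the orthogonality of rows a and b of W. A finite computation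
-- then shows that the counts depend only on the colour of (x, y). These are the intersection
-- numbers of the scheme, from which the Higman, 𝒦₂ and divisible design properties follow.

module Submission where

open import Defs
open import Data.Nat using (ℕ; _≤_; _*_; _+_; _∸_)
open import Data.Product using (_×_)
open import Data.Fin.Patterns using (3F; 4F)

open import Data.Bool using (Bool; true; false; not; _∧_; _∨_; _xor_; if_then_else_; T)
open import Data.Bool.Properties using (∧-idem; ∧-comm; ∧-zeroʳ; ∧-identityʳ; not-involutive)
import Data.Bool.Properties as BoolP
open import Data.Empty using (⊥-elim)
open import Data.Fin as Fin using (Fin; toℕ; fromℕ<)
open import Data.Fin.Patterns using (0F; 1F; 2F)
import Data.Fin.Properties as FinP
open import Data.Integer as ℤ using (ℤ; +_; -[1+_]; _◃_)
import Data.Integer.Properties as ℤP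
open import Data.List using (allFin; foldr; tabulate)
open import Data.List.Properties using (map-tabulate; map-cong)
open import Data.Nat as ℕ using (zero; suc; _<_; _≡ᵇ_; _/_; _%_; z≤n; s≤s; NonZero)
open import Data.Nat.DivMod
open import Data.Nat.Divisibility using (n∣m*n)
open import Data.Nat.Properties
  using (_≟_; ≡ᵇ⇒≡; <ᵇ⇒<; +-identityʳ; +-assoc; +-comm; +-cancelˡ-≡; *-zeroʳ; *-identityʳ; *-comm;
         *-distribˡ-+; *-cancelˡ-≡; ≤-antisym; ≤-reflexive; ≤-trans; <-irrefl; ≮⇒≥; m≤m+n; m<m+n;
         +-mono-≤; +-mono-<-≤; *-monoˡ-≤)
open import Data.Nat.Tactic.RingSolver using (solve-∀)
open import Data.Product using (Σ; ∃₂; _,_; proj₁; proj₂)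
open import Data.Product.Properties using (≡-dec)
open import Data.Sign as Sign using (Sign)
open import Data.Sum using (_⊎_; inj₁; inj₂; map₂)
open import Function using (_∘_)
open import Function.Bundles using (_⇔_; mk⇔; Equivalence)
open import Relation.Binary.PropositionalEquality hiding ([_])
open import Relation.Binary.Structures using (IsEquivalence)
open import Relation.Nullary using (¬_; Dec; yes; no)
open import Relation.Nullary.Decidable using (⌊_⌋; from-yes; map′; ¬?; _×-dec_; _⊎-dec_; _→-dec_)
open import Relation.Unary using (Decidable)

-- Sums over initial segments of ℕ

[_] : Bool → ℕ
[ b ] = if b then 1 else 0

when : Bool → ℕ → ℕ
when b k = if b then k else 0

∑ : ℕ → (ℕ → ℕ) → ℕ
∑ zero    f = 0
∑ (suc n) f = f 0 + ∑ n (f ∘ suc)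

syntax ∑ n (λ l → e) = ∑[ l < n ] e

∑-cong : ∀ n {f g : ℕ → ℕ} → (∀ l → l < n → f l ≡ g l) → ∑ n f ≡ ∑ n g
∑-cong zero    f≗g = refl
∑-cong (suc n) f≗g = cong₂ _+_ (f≗g 0 (s≤s z≤n)) (∑-cong n λ l l<n → f≗g (suc l) (s≤s l<n))

∑-distrib-+ : ∀ n (f g : ℕ → ℕ) → ∑[ l < n ] (f l + g l) ≡ ∑ n f + ∑ n g
∑-distrib-+ zero    f g = refl
∑-distrib-+ (suc n) f g = trans (cong (λ s → f 0 + g 0 + s) (∑-distrib-+ n (f ∘ suc) (g ∘ suc)))
                                (interchange (f 0) (g 0) _ _)
  where
  interchange : ∀ a b c d → a + b + (c + d) ≡ a + c + (b + d)
  interchange = solve-∀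

∑-when : ∀ n (p : ℕ → Bool) k → ∑[ l < n ] when (p l) k ≡ k * ∑[ l < n ] [ p l ]
∑-when zero    p k = sym (*-zeroʳ k)
∑-when (suc n) p k = trans (cong (λ s → when (p 0) k + s) (∑-when n (p ∘ suc) k)) (head (p 0))
  where
  head : ∀ b → when b k + k * ∑ n (λ l → [ p (suc l) ]) ≡ k * ([ b ] + ∑ n (λ l → [ p (suc l) ]))
  head true  = sym (trans (*-distribˡ-+ k 1 _) (cong (λ s → s + k * ∑ n (λ l → [ p (suc l) ])) (*-identityʳ k)))
  head false = refl

∑-++ : ∀ m n (f : ℕ → ℕ) → ∑ (m + n) f ≡ ∑ m f + ∑[ l < n ] f (m + l)
∑-++ zero    n f = refl
∑-++ (suc m) n f = trans (cong (λ s → f 0 + s) (∑-++ m n (f ∘ suc))) (sym (+-assoc (f 0) _ _))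

∑-* : ∀ m q (f : ℕ → ℕ) → ∑ (m * q) f ≡ ∑[ l < m ] ∑[ j < q ] f (l * q + j)
∑-* zero    q f = refl
∑-* (suc m) q f = trans (∑-++ q (m * q) f) (cong (λ s → ∑ q f + s) (trans (∑-* m q (λ k → f (q + k)))
  (∑-cong m λ l _ → ∑-cong q λ j _ → cong f (sym (+-assoc q (l * q) j)))))

∑-point : ∀ {n a} (f : ℕ → ℕ) → a < n → ∑[ l < n ] when (a ≡ᵇ l) (f l) ≡ f a
∑-point {suc n} {zero}  f _           = trans (cong (λ s → f 0 + s) (zeros n)) (+-identityʳ (f 0))
  where
  zeros : ∀ n → ∑[ l < n ] when (0 ≡ᵇ suc l) (f (suc l)) ≡ 0
  zeros zero    = refl
  zeros (suc n) = zeros n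
∑-point {suc n} {suc a} f (s≤s a<n) = ∑-point (f ∘ suc) a<n

∑-mono-≤ : ∀ n {f g : ℕ → ℕ} → (∀ l → l < n → f l ≤ g l) → ∑ n f ≤ ∑ n g
∑-mono-≤ zero    f≤g = z≤n
∑-mono-≤ (suc n) f≤g = +-mono-≤ (f≤g 0 (s≤s z≤n)) (∑-mono-≤ n λ l l<n → f≤g (suc l) (s≤s l<n))

+-mono-≤-≡ : ∀ {a b c d} → a ≤ c → b ≤ d → a + b ≡ c + d → a ≡ c × b ≡ d
+-mono-≤-≡ {a} {b} {c} {d} a≤c b≤d eq = a≡c , +-cancelˡ-≡ a b d (trans eq (cong (λ s → s + d) (sym a≡c)))
  where
  a≡c : a ≡ c
  a≡c = ≤-antisym a≤c (≮⇒≥ λ a<c → <-irrefl eq (+-mono-<-≤ a<c b≤d))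

∑-≤-≡ : ∀ n {f g : ℕ → ℕ} → (∀ l → l < n → f l ≤ g l) → ∑ n f ≡ ∑ n g → ∀ l → l < n → f l ≡ g l
∑-≤-≡ (suc n) {f} {g} f≤g ∑f≡∑g = pointwise
  where
  tail≤ : ∀ l → l < n → f (suc l) ≤ g (suc l)
  tail≤ l l<n = f≤g (suc l) (s≤s l<n)
  head-tail = +-mono-≤-≡ (f≤g 0 (s≤s z≤n)) (∑-mono-≤ n tail≤) ∑f≡∑g
  pointwise : ∀ l → l < suc n → f l ≡ g l
  pointwise zero    _         = proj₁ head-tail
  pointwise (suc l) (s≤s l<n) = ∑-≤-≡ n tail≤ (proj₂ head-tail) l l<n

∑-split : ∀ n (p q : ℕ → Bool) →
          ∑[ l < n ] [ p l ] ≡ ∑[ l < n ] [ p l ∧ q l ] + ∑[ l < n ] [ p l ∧ not (q l) ]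
∑-split n p q = trans (∑-cong n λ l _ → split (p l) (q l)) (∑-distrib-+ n _ _)
  where
  split : ∀ x y → [ x ] ≡ [ x ∧ y ] + [ x ∧ not y ]
  split true  true  = refl
  split true  false = refl
  split false _     = refl

∑-complement : ∀ n (p : ℕ → Bool) → ∑[ l < n ] [ p l ] + ∑[ l < n ] [ not (p l) ] ≡ n
∑-complement zero    p = refl
∑-complement (suc n) p = trans (shuffle [ p 0 ] [ not (p 0) ] _ _)
  (trans (cong (λ s → [ p 0 ] + [ not (p 0) ] + s) (∑-complement n (p ∘ suc))) (one (p 0)))
  where
  shuffle : ∀ a b c d → a + c + (b + d) ≡ a + b + (c + d)
  shuffle = solve-∀
  one : ∀ x → [ x ] + [ not x ] + n ≡ suc n
  one true  = refl
  one false = refl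

∑-zeros : ∀ n → ∑[ l < n ] 0 ≡ 0
∑-zeros zero    = refl
∑-zeros (suc n) = ∑-zeros n

∑-false : ∀ n {p : ℕ → Bool} → (∀ l → p l ≡ false) → ∑[ l < n ] [ p l ] ≡ 0
∑-false n p≡false = trans (∑-cong n λ l _ → cong [_] (p≡false l)) (∑-zeros n)

∑-remove : ∀ {n b} (p : ℕ → Bool) → b < n →
           ∑[ l < n ] [ p l ] ≡ [ p b ] + ∑[ l < n ] [ p l ∧ not (b ≡ᵇ l) ]
∑-remove {n} {b} p b<n = begin
  ∑[ l < n ] [ p l ]                                      ≡⟨ ∑-split n p (b ≡ᵇ_) ⟩
  ∑[ l < n ] [ p l ∧ (b ≡ᵇ l) ] + ∑[ l < n ] [ p l ∧ not (b ≡ᵇ l) ]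
      ≡⟨ cong (λ s → s + ∑[ l < n ] [ p l ∧ not (b ≡ᵇ l) ])
              (trans (∑-cong n λ l _ → ∧-when (p l) (b ≡ᵇ l)) (∑-point (λ l → [ p l ]) b<n)) ⟩
  [ p b ] + ∑[ l < n ] [ p l ∧ not (b ≡ᵇ l) ]            ∎
  where
  open ≡-Reasoning
  ∧-when : ∀ x y → [ x ∧ y ] ≡ when y [ x ]
  ∧-when x     false = cong [_] (∧-zeroʳ x)
  ∧-when true  true  = refl
  ∧-when false true  = refl

double-injective : ∀ {x y} → x + x ≡ y + y → x ≡ y
double-injective {x} {y} eq = *-cancelˡ-≡ x y 2 (trans (double x) (trans eq (sym (double y))))
  where
  double : ∀ x → 2 * x ≡ x + x
  double x = cong (λ s → x + s) (+-identityʳ x)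

count-∑ : ∀ N (P : ℕ → Bool) → count N (λ z → P (toℕ z)) ≡ ∑[ k < N ] [ P k ]
count-∑ N P = trans (cong (foldr _+_ 0) (map-tabulate {n = N} (λ z → z) (λ z → [ P (toℕ z) ]))) (go N P)
  where
  go : ∀ N (P : ℕ → Bool) → foldr _+_ 0 (tabulate {n = N} (λ z → [ P (toℕ z) ])) ≡ ∑[ k < N ] [ P k ]
  go zero    P = refl
  go (suc N) P = cong (λ s → [ P 0 ] + s) (go N (P ∘ suc))

count-cong : ∀ N {P Q : Fin N → Bool} → (∀ z → P z ≡ Q z) → count N P ≡ count N Q
count-cong N P≗Q = cong (foldr _+_ 0) (map-cong (λ z → cong [_] (P≗Q z)) (allFin N))

sumℤ-cong : ∀ N {f g : Fin N → ℤ} → (∀ z → f z ≡ g z) → sumℤ N f ≡ sumℤ N g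
sumℤ-cong N f≗g = cong (foldr ℤ._+_ (+ 0)) (map-cong f≗g (allFin N))

sumℤ-ℕ : ∀ N (f : ℕ → ℕ) → sumℤ N (λ z → + f (toℕ z)) ≡ + ∑ N f
sumℤ-ℕ N f = trans (cong (foldr ℤ._+_ (+ 0)) (map-tabulate {n = N} (λ z → z) (λ z → + f (toℕ z)))) (go N f)
  where
  go : ∀ N (f : ℕ → ℕ) → foldr ℤ._+_ (+ 0) (tabulate {n = N} (λ z → + f (toℕ z))) ≡ + ∑ N f
  go zero    f = refl
  go (suc N) f = trans (cong (λ s → + f 0 ℤ.+ s) (go N (f ∘ suc))) (sym (ℤP.pos-+ (f 0) _))

sumℤ-ℕ-difference : ∀ N (f g : ℕ → ℕ) →
  sumℤ N (λ z → + f (toℕ z) ℤ.- + g (toℕ z)) ≡ + ∑ N f ℤ.- + ∑ N g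
sumℤ-ℕ-difference N f g =
  trans (cong (foldr ℤ._+_ (+ 0)) (map-tabulate {n = N} (λ z → z) (λ z → + f (toℕ z) ℤ.- + g (toℕ z)))) (go N f g)
  where
  open import Data.Integer.Tactic.RingSolver using () renaming (solve-∀ to solveℤ-∀)
  regroup : ∀ a b c d → (a ℤ.- b) ℤ.+ (c ℤ.- d) ≡ (a ℤ.+ c) ℤ.- (b ℤ.+ d)
  regroup = solveℤ-∀
  go : ∀ N (f g : ℕ → ℕ) → foldr ℤ._+_ (+ 0) (tabulate {n = N} (λ z → + f (toℕ z) ℤ.- + g (toℕ z)))
                          ≡ + ∑ N f ℤ.- + ∑ N g
  go zero    f g = refl
  go (suc N) f g = begin
    (+ f 0 ℤ.- + g 0) ℤ.+ _
        ≡⟨ cong (λ s → (+ f 0 ℤ.- + g 0) ℤ.+ s) (go N (f ∘ suc) (g ∘ suc)) ⟩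
    (+ f 0 ℤ.- + g 0) ℤ.+ (+ ∑ N (f ∘ suc) ℤ.- + ∑ N (g ∘ suc))
        ≡⟨ regroup (+ f 0) (+ g 0) (+ ∑ N (f ∘ suc)) (+ ∑ N (g ∘ suc)) ⟩
    (+ f 0 ℤ.+ + ∑ N (f ∘ suc)) ℤ.- (+ g 0 ℤ.+ + ∑ N (g ∘ suc))
        ≡⟨ sym (cong₂ ℤ._-_ (ℤP.pos-+ (f 0) _) (ℤP.pos-+ (g 0) _)) ⟩
    + ∑ (suc N) f ℤ.- + ∑ (suc N) g ∎
    where open ≡-Reasoning

∧-shared : ∀ x y z → (x ∧ y) ∧ (x ∧ z) ≡ (x ∧ y) ∧ z
∧-shared true  _ _ = refl
∧-shared false _ _ = refl

∧-disjoint : ∀ x y p q → x ∧ y ≡ false → (x ∧ p) ∧ (y ∧ q) ≡ false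
∧-disjoint true  true  _ _ ()
∧-disjoint true  false p _ _ = ∧-zeroʳ p
∧-disjoint false _     _ _ _ = refl

∧-not-disjoint : ∀ x y p → x ∧ y ≡ false → (x ∧ p) ∧ not y ≡ x ∧ p
∧-not-disjoint true  true  _ ()
∧-not-disjoint true  false p _ = ∧-identityʳ p
∧-not-disjoint false _     _ _ = refl

not-∧-disjoint : ∀ x y → x ∧ y ≡ false → not x ∧ y ≡ y
not-∧-disjoint true  true  ()
not-∧-disjoint true  false _ = refl
not-∧-disjoint false _     _ = refl

when-∧ : ∀ x y k → when (x ∧ y) k ≡ when x (when y k)
when-∧ true  _ _ = refl
when-∧ false _ _ = refl

≡ᵇ-refl : ∀ n → (n ≡ᵇ n) ≡ true
≡ᵇ-refl zero    = refl
≡ᵇ-refl (suc n) = ≡ᵇ-refl n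

≡ᵇ-true : ∀ m n → (m ≡ᵇ n) ≡ true → m ≡ n
≡ᵇ-true m n eq = ≡ᵇ⇒≡ m n (subst T (sym eq) _)

≡ᵇ-false : ∀ {m n} → m ≢ n → (m ≡ᵇ n) ≡ false
≡ᵇ-false {m} {n} m≢n with m ≡ᵇ n in eq
... | true  = ⊥-elim (m≢n (≡ᵇ-true m n eq))
... | false = refl

≡ᵇ-false⇒≢ : ∀ m n → (m ≡ᵇ n) ≡ false → m ≢ n
≡ᵇ-false⇒≢ m _ eq refl with () ← trans (sym (≡ᵇ-refl m)) eq

≡ᵇ-sym : ∀ m n → (m ≡ᵇ n) ≡ (n ≡ᵇ m)
≡ᵇ-sym zero    zero    = refl
≡ᵇ-sym zero    (suc n) = refl
≡ᵇ-sym (suc m) zero    = refl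
≡ᵇ-sym (suc m) (suc n) = ≡ᵇ-sym m n

[m*q+j]/q≡m : ∀ m q {j} .{{_ : NonZero q}} → j < q → (m * q + j) / q ≡ m
[m*q+j]/q≡m m q {j} j<q = begin
  (m * q + j) / q     ≡⟨ +-distrib-/-∣ˡ j (n∣m*n m) ⟩
  m * q / q + j / q   ≡⟨ cong₂ _+_ (m*n/n≡m m q) (m<n⇒m/n≡0 j<q) ⟩
  m + 0               ≡⟨ +-identityʳ m ⟩
  m                   ∎
  where open ≡-Reasoning

[m*q+j]%q≡j : ∀ m q {j} .{{_ : NonZero q}} → j < q → (m * q + j) % q ≡ j
[m*q+j]%q≡j m q {j} j<q = trans (%-remove-+ˡ j (n∣m*n m)) (m<n⇒m%n≡m j<q)

≡ᵇ-by-divMod : ∀ x y q .{{_ : NonZero q}} → (x ≡ᵇ y) ≡ ((x / q ≡ᵇ y / q) ∧ (x % q ≡ᵇ y % q))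
≡ᵇ-by-divMod x y q with x ≟ y
... | yes refl rewrite ≡ᵇ-refl x | ≡ᵇ-refl (x / q) | ≡ᵇ-refl (x % q) = refl
... | no x≢y rewrite ≡ᵇ-false x≢y with x / q ≡ᵇ y / q in eq/ | x % q ≡ᵇ y % q in eq%
...   | true  | true  = ⊥-elim (x≢y (begin
          x                   ≡⟨ m≡m%n+[m/n]*n x q ⟩
          x % q + x / q * q   ≡⟨ cong₂ (λ r d → r + d * q) (≡ᵇ-true (x % q) (y % q) eq%) (≡ᵇ-true (x / q) (y / q) eq/) ⟩
          y % q + y / q * q   ≡⟨ sym (m≡m%n+[m/n]*n y q) ⟩
          y                   ∎))
          where open ≡-Reasoning
...   | true  | false = refl
...   | false | _     = refl

∑-block : ∀ m q .{{_ : NonZero q}} {A} → A < m → ∑[ l < m * q ] [ A ≡ᵇ l / q ] ≡ q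
∑-block m q {A} A<m = begin
  ∑[ l < m * q ] [ A ≡ᵇ l / q ]
      ≡⟨ ∑-* m q _ ⟩
  ∑[ C < m ] ∑[ j < q ] [ A ≡ᵇ (C * q + j) / q ]
      ≡⟨ ∑-cong m (λ C _ → ∑-cong q λ j j<q → cong (λ d → [ A ≡ᵇ d ]) ([m*q+j]/q≡m C q j<q)) ⟩
  ∑[ C < m ] ∑[ j < q ] [ A ≡ᵇ C ]
      ≡⟨ ∑-cong m (λ C _ → constant q (A ≡ᵇ C)) ⟩
  ∑[ C < m ] when (A ≡ᵇ C) q
      ≡⟨ ∑-point (λ _ → q) A<m ⟩
  q ∎
  where
  open ≡-Reasoning
  constant : ∀ q b → ∑[ j < q ] [ b ] ≡ when b q
  constant zero    true  = refl
  constant (suc q) true  = cong suc (constant q true)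
  constant zero    false = refl
  constant (suc q) false = constant q false

Affine : Set
Affine = ℕ × ℕ

⟦_⟧ : Affine → ℕ → ℕ
⟦ a , b ⟧ u = a + b * u

infixr 5 _⊕_
infixr 6 _⊙_

_⊕_ : Affine → Affine → Affine
(a , b) ⊕ (c , d) = a + c , b + d

_⊙_ : ℕ → Affine → Affine
k ⊙ (a , b) = k * a , k * b

⟦⊕⟧ : ∀ p q u → ⟦ p ⊕ q ⟧ u ≡ ⟦ p ⟧ u + ⟦ q ⟧ u
⟦⊕⟧ (a , b) (c , d) u = regroup a b c d u
  where
  regroup : ∀ a b c d u → a + c + (b + d) * u ≡ a + b * u + (c + d * u)
  regroup = solve-∀

⟦⊙⟧ : ∀ k p u → ⟦ k ⊙ p ⟧ u ≡ k * ⟦ p ⟧ u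
⟦⊙⟧ k (a , b) u = distribute k a b u
  where
  distribute : ∀ k a b u → k * a + k * b * u ≡ k * (a + b * u)
  distribute = solve-∀

-- Links between indices and colours of pairs of vertices

data Link : Set where
  self mate : Link
  off       : Sign → Link

isSelf isMate isOff : Link → Bool
isSelf self = true
isSelf _    = false
isMate mate = true
isMate _    = false
isOff (off _) = true
isOff _       = false

entry : Link → ℤ
entry (off σ) = σ ◃ 1
entry _       = + 0

classify : Bool → Bool → ℤ → Link
classify true  _     _ = self
classify false true  _ = mate
classify false false x = off (ℤ.sign x)

flip : Link → Link
flip (off σ) = off (Sign.opposite σ)
flip r       = r

-- The colour of a pair of vertices (a, e), (b, g) with link r between a and b,
-- where p says whether the parities e and g agree.
colour : Link → Bool → Fin 5
colour self         p = if p then 0F else 1F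
colour mate         _ = 2F
colour (off Sign.+) p = if p then 3F else 4F
colour (off Sign.-) p = if p then 4F else 3F

colour-flip : ∀ r p → r ≢ self → colour (flip r) p ≡ colour r (not p)
colour-flip self         _     r≢self = ⊥-elim (r≢self refl)
colour-flip mate         _     _      = refl
colour-flip (off Sign.+) true  _      = refl
colour-flip (off Sign.+) false _      = refl
colour-flip (off Sign.-) true  _      = refl
colour-flip (off Sign.-) false _      = refl

bothMates mateOff offMate offOff sameSign oppositeSign : Link → Link → Bool
bothMates r₁ r₂ = isMate r₁ ∧ isMate r₂
mateOff  r₁ r₂ = isMate r₁ ∧ isOff r₂
offMate  r₁ r₂ = mateOff r₂ r₁
offOff   r₁ r₂ = isOff r₁ ∧ isOff r₂
sameSign (off Sign.+) (off Sign.+) = true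
sameSign (off Sign.-) (off Sign.-) = true
sameSign _            _            = false
oppositeSign (off Sign.+) (off Sign.-) = true
oppositeSign (off Sign.-) (off Sign.+) = true
oppositeSign _            _            = false

FlipInvariant : (Link → Link → ℕ) → Set
FlipInvariant F = ∀ r₁ r₂ → r₁ ≢ self → r₂ ≢ self → F (flip r₁) (flip r₂) ≡ F r₁ r₂

-- Sorts an index l by the pair (link a l, link l b); up to a simultaneous change of
-- sign, which F does not see, the pair is determined by the category it falls in.
decompose : ∀ F → FlipInvariant F → ∀ r₁ r₂ →
  F r₁ r₂ ≡ when (isSelf r₁) (F self r₂)
          + (when (isSelf r₂ ∧ not (isSelf r₁)) (F r₁ self)
          + (when (bothMates r₁ r₂) (F mate mate)
          + (when (mateOff r₁ r₂) (F mate (off Sign.+))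
          + (when (offMate r₁ r₂) (F (off Sign.+) mate)
          + (when (sameSign r₁ r₂) (F (off Sign.+) (off Sign.+))
          +  when (oppositeSign r₁ r₂) (F (off Sign.+) (off Sign.-)))))))
decompose F F-flip self         self         = sym (+-identityʳ _)
decompose F F-flip self         mate         = sym (+-identityʳ _)
decompose F F-flip self         (off Sign.+) = sym (+-identityʳ _)
decompose F F-flip self         (off Sign.-) = sym (+-identityʳ _)
decompose F F-flip mate         self         = sym (+-identityʳ _)
decompose F F-flip mate         mate         = sym (+-identityʳ _)
decompose F F-flip mate         (off Sign.+) = sym (+-identityʳ _)
decompose F F-flip mate         (off Sign.-) =
  trans (F-flip mate (off Sign.+) (λ ()) (λ ())) (sym (+-identityʳ _))
decompose F F-flip (off Sign.+) self         = sym (+-identityʳ _)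
decompose F F-flip (off Sign.+) mate         = sym (+-identityʳ _)
decompose F F-flip (off Sign.+) (off Sign.+) = sym (+-identityʳ _)
decompose F F-flip (off Sign.+) (off Sign.-) = refl
decompose F F-flip (off Sign.-) self         = sym (+-identityʳ _)
decompose F F-flip (off Sign.-) mate         =
  trans (F-flip (off Sign.+) mate (λ ()) (λ ())) (sym (+-identityʳ _))
decompose F F-flip (off Sign.-) (off Sign.+) = F-flip (off Sign.+) (off Sign.-) (λ ()) (λ ())
decompose F F-flip (off Sign.-) (off Sign.-) =
  trans (F-flip (off Sign.+) (off Sign.+) (λ ()) (λ ())) (sym (+-identityʳ _))

-- The number of indices l in each category when a and b have the given link, as a
-- function of u = t - 2.
#bothMates #mateOff #sameSign #oppositeSign : Link → Affine
#bothMates self    = 3 , 0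
#bothMates mate    = 2 , 0
#bothMates (off _) = 0 , 0
#mateOff (off _) = 3 , 0
#mateOff _       = 0 , 0
#sameSign self    = 4 , 4
#sameSign mate    = 2 , 2
#sameSign (off _) = 0 , 2
#oppositeSign self    = 0 , 0
#oppositeSign mate    = 2 , 2
#oppositeSign (off _) = 0 , 2

indexCount : (Link → Link → ℕ) → Link → Affine
indexCount F r = (F self r , 0)
               ⊕ (when (not (isSelf r)) (F r self) , 0)
               ⊕ F mate mate ⊙ #bothMates r
               ⊕ F mate (off Sign.+) ⊙ #mateOff r
               ⊕ F (off Sign.+) mate ⊙ #mateOff r
               ⊕ F (off Sign.+) (off Sign.+) ⊙ #sameSign r
               ⊕ F (off Sign.+) (off Sign.-) ⊙ #oppositeSign r

⟦indexCount⟧ : ∀ F r u → ⟦ indexCount F r ⟧ u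
  ≡ F self r + (when (not (isSelf r)) (F r self)
  + (F mate mate * ⟦ #bothMates r ⟧ u
  + (F mate (off Sign.+) * ⟦ #mateOff r ⟧ u
  + (F (off Sign.+) mate * ⟦ #mateOff r ⟧ u
  + (F (off Sign.+) (off Sign.+) * ⟦ #sameSign r ⟧ u
  +  F (off Sign.+) (off Sign.-) * ⟦ #oppositeSign r ⟧ u)))))
⟦indexCount⟧ F r u =
  step (F self r , 0) from-other (+-identityʳ (F self r))
  (step (when (not (isSelf r)) (F r self) , 0) from-bothMates (+-identityʳ _)
  (step (F mate mate ⊙ #bothMates r) from-mateOff (⟦⊙⟧ (F mate mate) (#bothMates r) u)
  (step (F mate (off Sign.+) ⊙ #mateOff r) from-offMate (⟦⊙⟧ (F mate (off Sign.+)) (#mateOff r) u)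
  (step (F (off Sign.+) mate ⊙ #mateOff r) from-sameSign (⟦⊙⟧ (F (off Sign.+) mate) (#mateOff r) u)
  (step (F (off Sign.+) (off Sign.+) ⊙ #sameSign r) (F (off Sign.+) (off Sign.-) ⊙ #oppositeSign r)
        (⟦⊙⟧ (F (off Sign.+) (off Sign.+)) (#sameSign r) u)
        (⟦⊙⟧ (F (off Sign.+) (off Sign.-)) (#oppositeSign r) u))))))
  where
  from-other from-bothMates from-mateOff from-offMate from-sameSign : Affine
  from-sameSign  = F (off Sign.+) (off Sign.+) ⊙ #sameSign r ⊕ F (off Sign.+) (off Sign.-) ⊙ #oppositeSign r
  from-offMate   = F (off Sign.+) mate ⊙ #mateOff r ⊕ from-sameSign
  from-mateOff   = F mate (off Sign.+) ⊙ #mateOff r ⊕ from-offMate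
  from-bothMates = F mate mate ⊙ #bothMates r ⊕ from-mateOff
  from-other     = (when (not (isSelf r)) (F r self) , 0) ⊕ from-bothMates
  step : ∀ p q {x y} → ⟦ p ⟧ u ≡ x → ⟦ q ⟧ u ≡ y → ⟦ p ⊕ q ⟧ u ≡ x + y
  step p q p≡x q≡y = trans (⟦⊕⟧ p q u) (cong₂ _+_ p≡x q≡y)

∀-Bool? : {P : Bool → Set} → Decidable P → Dec (∀ b → P b)
∀-Bool? P? = map′ (λ { (t , f) true → t ; (t , f) false → f }) (λ h → h true , h false)
                  (P? true ×-dec P? false)

∀-Link? : {P : Link → Set} → Decidable P → Dec (∀ r → P r)
∀-Link? P? = map′
  (λ { (s , b , p , m) self → s ; (s , b , p , m) mate → b
     ; (s , b , p , m) (off Sign.+) → p ; (s , b , p , m) (off Sign.-) → m })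
  (λ h → h self , h mate , h (off Sign.+) , h (off Sign.-))
  (P? self ×-dec P? mate ×-dec P? (off Sign.+) ×-dec P? (off Sign.-))

mateOff-diagonal : ∀ r → mateOff r r ≡ false
mateOff-diagonal = from-yes (∀-Link? λ r → mateOff r r BoolP.≟ false)

sameSign-diagonal : ∀ r → sameSign r r ≡ isOff r
sameSign-diagonal = from-yes (∀-Link? λ r → sameSign r r BoolP.≟ isOff r)

oppositeSign-diagonal : ∀ r → oppositeSign r r ≡ false
oppositeSign-diagonal = from-yes (∀-Link? λ r → oppositeSign r r BoolP.≟ false)

sameSign+oppositeSign : ∀ r₁ r₂ → [ sameSign r₁ r₂ ] + [ oppositeSign r₁ r₂ ] ≡ [ offOff r₁ r₂ ]
sameSign+oppositeSign = from-yes (∀-Link? λ r₁ → ∀-Link? λ r₂ →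
  [ sameSign r₁ r₂ ] + [ oppositeSign r₁ r₂ ] ≟ [ offOff r₁ r₂ ])

entry-product : ∀ r₁ r₂ → entry r₁ ℤ.* entry r₂ ≡ + [ sameSign r₁ r₂ ] ℤ.- + [ oppositeSign r₁ r₂ ]
entry-product = from-yes (∀-Link? λ r₁ → ∀-Link? λ r₂ →
  entry r₁ ℤ.* entry r₂ ℤ.≟ + [ sameSign r₁ r₂ ] ℤ.- + [ oppositeSign r₁ r₂ ])

colour-diagonal : ∀ r p → colour r p ≡ 0F → isSelf r ∧ p ≡ true
colour-diagonal = from-yes (∀-Link? λ r → ∀-Bool? λ p →
  (colour r p Fin.≟ 0F) →-dec (isSelf r ∧ p BoolP.≟ true))

colour-fibre : ∀ r p → colour r p ≡ 0F ⊎ colour r p ≡ 1F → isSelf r ≡ true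
colour-fibre = from-yes (∀-Link? λ r → ∀-Bool? λ p →
  ((colour r p Fin.≟ 0F) ⊎-dec (colour r p Fin.≟ 1F)) →-dec (isSelf r BoolP.≟ true))

colour-block : ∀ r p → colour r p ≡ 0F ⊎ colour r p ≡ 1F ⊎ colour r p ≡ 2F → isOff r ≡ false
colour-block = from-yes (∀-Link? λ r → ∀-Bool? λ p →
  ((colour r p Fin.≟ 0F) ⊎-dec (colour r p Fin.≟ 1F) ⊎-dec (colour r p Fin.≟ 2F))
  →-dec (isOff r BoolP.≟ false))

colour-off-onto : ∀ σ α → α ≡ 3F ⊎ α ≡ 4F → Σ Bool λ p → colour (off σ) p ≡ α
colour-off-onto Sign.+ _ (inj₁ refl) = true  , refl
colour-off-onto Sign.+ _ (inj₂ refl) = false , refl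
colour-off-onto Sign.- _ (inj₁ refl) = false , refl
colour-off-onto Sign.- _ (inj₂ refl) = true  , refl

colour-self : ∀ p → colour self p ≡ 0F ⊎ colour self p ≡ 1F
colour-self true  = inj₁ refl
colour-self false = inj₂ refl

colour-notOff : ∀ r p → isOff r ≡ false → colour r p ≡ 0F ⊎ colour r p ≡ 1F ⊎ colour r p ≡ 2F
colour-notOff self    p _ = map₂ inj₁ (colour-self p)
colour-notOff mate    _ _ = inj₂ (inj₂ refl)
colour-notOff (off _) _ ()

𝟙 : Bool → ℤ
𝟙 b = if b then + 1 else + 0

⌊𝟙≟1⌋ : ∀ b → ⌊ 𝟙 b ℤ.≟ + 1 ⌋ ≡ b
⌊𝟙≟1⌋ true  = refl
⌊𝟙≟1⌋ false = refl

𝟙-colour₀ : ∀ r p → 𝟙 (isSelf r ∧ p) ≡ 𝟙 ⌊ colour r p Fin.≟ 0F ⌋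
𝟙-colour₀ = from-yes (∀-Link? λ r → ∀-Bool? λ p → 𝟙 (isSelf r ∧ p) ℤ.≟ 𝟙 ⌊ colour r p Fin.≟ 0F ⌋)

𝟙-colour₁ : ∀ r p → 𝟙 (isSelf r) ℤ.* (+ 1 ℤ.- 𝟙 p) ≡ 𝟙 ⌊ colour r p Fin.≟ 1F ⌋
𝟙-colour₁ = from-yes (∀-Link? λ r → ∀-Bool? λ p →
  𝟙 (isSelf r) ℤ.* (+ 1 ℤ.- 𝟙 p) ℤ.≟ 𝟙 ⌊ colour r p Fin.≟ 1F ⌋)

𝟙-colour₂ : ∀ r p → 𝟙 (isMate r) ≡ 𝟙 ⌊ colour r p Fin.≟ 2F ⌋
𝟙-colour₂ = from-yes (∀-Link? λ r → ∀-Bool? λ p → 𝟙 (isMate r) ℤ.≟ 𝟙 ⌊ colour r p Fin.≟ 2F ⌋)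

𝟙-colour₃ : ∀ r i j → block (entry r) i j ≡ 𝟙 ⌊ colour r (i ≡ᵇ j) Fin.≟ 3F ⌋
𝟙-colour₃ self         i j with i ≡ᵇ j
... | true  = refl
... | false = refl
𝟙-colour₃ mate         i j = refl
𝟙-colour₃ (off Sign.+) i j with i ≡ᵇ j
... | true  = refl
... | false = refl
𝟙-colour₃ (off Sign.-) i j with i ≡ᵇ j
... | true  = refl
... | false = refl

𝟙-colour₄ : ∀ (γ : Fin 5) →
  + 1 ℤ.- 𝟙 ⌊ γ Fin.≟ 0F ⌋ ℤ.- 𝟙 ⌊ γ Fin.≟ 1F ⌋ ℤ.- 𝟙 ⌊ γ Fin.≟ 2F ⌋ ℤ.- 𝟙 ⌊ γ Fin.≟ 3F ⌋
  ≡ 𝟙 ⌊ γ Fin.≟ 4F ⌋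
𝟙-colour₄ 0F = refl
𝟙-colour₄ 1F = refl
𝟙-colour₄ 2F = refl
𝟙-colour₄ 3F = refl
𝟙-colour₄ 4F = refl

PairPredicate : Set
PairPredicate = Fin 5 → Fin 5 → Bool

-- Counts the two vertices (l, 0), (l, 1) over an index l; e and g say whether x and y are even.
overIndex : PairPredicate → Bool → Bool → Link → Link → ℕ
overIndex P e g r₁ r₂ = [ P (colour r₁ e) (colour r₂ g) ] + [ P (colour r₁ (not e)) (colour r₂ (not g)) ]

overIndex-flipInvariant : ∀ P e g → FlipInvariant (overIndex P e g)
overIndex-flipInvariant P e g r₁ r₂ r₁≢self r₂≢self = begin
  [ P (colour (flip r₁) e) (colour (flip r₂) g) ]
    + [ P (colour (flip r₁) (not e)) (colour (flip r₂) (not g)) ]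
      ≡⟨ cong₂ _+_ (cong₂ (λ γ δ → [ P γ δ ]) (colour-flip r₁ e r₁≢self) (colour-flip r₂ g r₂≢self))
                   (cong₂ (λ γ δ → [ P γ δ ]) (flip-not r₁ e r₁≢self) (flip-not r₂ g r₂≢self)) ⟩
  [ P (colour r₁ (not e)) (colour r₂ (not g)) ] + [ P (colour r₁ e) (colour r₂ g) ]
      ≡⟨ +-comm [ P (colour r₁ (not e)) (colour r₂ (not g)) ] _ ⟩
  overIndex P e g r₁ r₂ ∎
  where
  open ≡-Reasoning
  flip-not : ∀ r p → r ≢ self → colour (flip r) (not p) ≡ colour r p
  flip-not r p r≢self = trans (colour-flip r (not p) r≢self) (cong (colour r) (not-involutive p))

pairColour : Link → Bool → Bool → Fin 5
pairColour r e g = colour r (not (e xor g))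

pairCount : PairPredicate → Link → Bool → Bool → Affine
pairCount P r e g = indexCount (overIndex P e g) r

representative : Fin 5 → Link × Bool × Bool
representative 0F = self       , true , true
representative 1F = self       , true , false
representative 2F = mate       , true , true
representative 3F = off Sign.+ , true , true
representative 4F = off Sign.+ , true , false

intersection : PairPredicate → Fin 5 → Affine
intersection P γ with representative γ
... | r , e , g = pairCount P r e g

ColourDetermined : PairPredicate → Set
ColourDetermined P = ∀ r e g → pairCount P r e g ≡ intersection P (pairColour r e g)

colourDetermined? : ∀ P → Dec (ColourDetermined P)
colourDetermined? P = ∀-Link? λ r → ∀-Bool? λ e → ∀-Bool? λ g → ≡-dec _≟_ _≟_ _ _

isPair : Fin 5 → Fin 5 → PairPredicate
isPair α β γ δ = ⌊ γ Fin.≟ α ⌋ ∧ ⌊ δ Fin.≟ β ⌋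

adjacent : Fin 5 → Fin 5 → Bool
adjacent i γ = ⌊ γ Fin.≟ 2F ⌋ ∨ ⌊ γ Fin.≟ i ⌋

bothAdjacent : Fin 5 → PairPredicate
bothAdjacent i γ δ = adjacent i γ ∧ adjacent i δ

isPair-colourDetermined : ∀ α β → ColourDetermined (isPair α β)
isPair-colourDetermined = from-yes (FinP.all? λ α → FinP.all? λ β → colourDetermined? (isPair α β))

bothAdjacent-colourDetermined : ∀ i → ColourDetermined (bothAdjacent i)
bothAdjacent-colourDetermined = from-yes (FinP.all? λ i → colourDetermined? (bothAdjacent i))

common-fibre : ∀ i → i ≡ 3F ⊎ i ≡ 4F →
               intersection (bothAdjacent i) 0F ≡ (10 , 4) × intersection (bothAdjacent i) 1F ≡ (6 , 0)
common-fibre _ (inj₁ refl) = refl , refl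
common-fibre _ (inj₂ refl) = refl , refl

common-offFibre : ∀ i γ → i ≡ 3F ⊎ i ≡ 4F → ¬ (γ ≡ 0F ⊎ γ ≡ 1F) → intersection (bothAdjacent i) γ ≡ (6 , 2)
common-offFibre = from-yes (FinP.all? λ i → FinP.all? λ γ → ((i Fin.≟ 3F) ⊎-dec (i Fin.≟ 4F)) →-dec
  (¬? ((γ Fin.≟ 0F) ⊎-dec (γ Fin.≟ 1F)) →-dec ≡-dec _≟_ _≟_ (intersection (bothAdjacent i) γ) (6 , 2)))


∨-≟ : ∀ {n} (γ α β : Fin n) → (⌊ γ Fin.≟ α ⌋ ∨ ⌊ γ Fin.≟ β ⌋ ≡ true) ⇔ (γ ≡ α ⊎ γ ≡ β)
∨-≟ γ α β with γ Fin.≟ α | γ Fin.≟ β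
... | yes γ≡α | _       = mk⇔ (λ _ → inj₁ γ≡α) (λ _ → refl)
... | no _    | yes γ≡β = mk⇔ (λ _ → inj₂ γ≡β) (λ _ → refl)
... | no γ≢α  | no γ≢β  = mk⇔ (λ ())
  λ { (inj₁ γ≡α) → ⊥-elim (γ≢α γ≡α) ; (inj₂ γ≡β) → ⊥-elim (γ≢β γ≡β) }

fromℕ<-≟ : ∀ {m k} (m<k : m < k) (a : Fin k) → ⌊ fromℕ< m<k Fin.≟ a ⌋ ≡ (toℕ a ≡ᵇ m)
fromℕ<-≟ {m} m<k a with fromℕ< m<k Fin.≟ a
... | yes refl = sym (trans (cong (λ i → i ≡ᵇ m) (FinP.toℕ-fromℕ< m<k)) (≡ᵇ-refl m))
... | no ≢     = sym (≡ᵇ-false λ a≡m → ≢ (FinP.toℕ-injective (trans (FinP.toℕ-fromℕ< m<k) (sym a≡m))))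

kernel-isEquivalence : ∀ {A B : Set} {R : A → A → Set} (f : A → B) →
                       (∀ x y → R x y ⇔ (f x ≡ f y)) → IsEquivalence R
kernel-isEquivalence f R⇔ = record
  { refl  = λ {x} → from (R⇔ x x) refl
  ; sym   = λ {x} {y} Rxy → from (R⇔ y x) (sym (to (R⇔ x y) Rxy))
  ; trans = λ {x} {y} {z} Rxy Ryz → from (R⇔ x z) (trans (to (R⇔ x y) Rxy) (to (R⇔ y z) Ryz))
  }
  where open Equivalence

valencyAt≡interNum : ∀ {N d} (c : Fin N → Fin N → Fin d) → (∀ x y → c x y ≡ c y x) →
                     ∀ x α → valencyAt c x α ≡ interNum c x x α α
valencyAt≡interNum {N} c c-sym x α = count-cong N λ y →
  trans (sym (∧-idem _)) (cong (λ γ → ⌊ c x y Fin.≟ α ⌋ ∧ ⌊ γ Fin.≟ α ⌋) (c-sym x y))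

degree≡common : ∀ N (adj : Fin N → Fin N → Bool) x → degree N adj x ≡ common N adj x x
degree≡common N adj x = count-cong N λ z → sym (∧-idem (adj x z))

-- If r s = s and r relates x ≠ y, then every s-neighbour of y is an s-neighbour of x,
-- which forces c_{αα}^{c(y,x)} = n_α.
radical-trivial : ∀ {N d} (c : Fin N → Fin N → Fin d) α → (∀ x y → c x y ≡ c y x) →
                  (∀ x y → x ≢ y → interNum c x y α α ≢ valencyAt c x α) → RadTrivial N (basisRel c α)
radical-trivial {N} c α c-sym separated r r∘s≐s _ x y rxy with x Fin.≟ y
... | yes x≡y = x≡y
... | no x≢y  = ⊥-elim (separated y x (λ y≡x → x≢y (sym y≡x)) (count-cong N pointwise))
  where
  pointwise : ∀ w → (⌊ c y w Fin.≟ α ⌋ ∧ ⌊ c w x Fin.≟ α ⌋) ≡ ⌊ c y w Fin.≟ α ⌋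
  pointwise w with c y w Fin.≟ α
  ... | no _ = refl
  ... | yes cyw≡α with c w x Fin.≟ α
  ...   | yes _     = refl
  ...   | no cwx≢α  = ⊥-elim (cwx≢α (trans (c-sym w x) (Equivalence.to (r∘s≐s x w) (y , rxy , cyw≡α))))

module Construction
  (u : ℕ) (W : FMat (4 * (2 + u)))
  (W-weighing : IsWeighing (4 * (2 + u)) (4 * (1 + u)) W)
  (W-symmetric : IsSymmetricMat (4 * (2 + u)) W)
  (W-blocks : ZeroDiag4Blocks (4 * (2 + u)) W)
  where

  t n : ℕ
  t = 2 + u
  n = 4 * t

  A : ℕ → ℕ → ℤ
  A = extend n W

  A-fromℕ< : ∀ {a b} (a<n : a < n) (b<n : b < n) → A a b ≡ W (fromℕ< a<n) (fromℕ< b<n)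
  A-fromℕ< {a} {b} a<n b<n with a ℕ.<? n | b ℕ.<? n
  ... | yes _   | yes _   = refl
  ... | no a≮n  | _       = ⊥-elim (a≮n a<n)
  ... | yes _   | no b≮n  = ⊥-elim (b≮n b<n)

  A-entries : ∀ a b → A a b ≡ + 0 ⊎ A a b ≡ + 1 ⊎ A a b ≡ -[1+ 0 ]
  A-entries a b with a ℕ.<? n | b ℕ.<? n
  ... | yes _ | yes _ = proj₁ W-weighing _ _
  ... | yes _ | no _  = inj₁ refl
  ... | no _  | _     = inj₁ refl

  A-symmetric : ∀ a b → A a b ≡ A b a
  A-symmetric a b with a ℕ.<? n | b ℕ.<? n
  ... | yes _ | yes _ = W-symmetric _ _
  ... | yes _ | no _  = refl
  ... | no _  | yes _ = refl
  ... | no _  | no _  = refl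

  A-blocks : ∀ a b → a / 4 ≡ b / 4 → A a b ≡ + 0
  A-blocks a b a/4≡b/4 with a ℕ.<? n | b ℕ.<? n
  ... | yes a<n | yes b<n = W-blocks _ _
        (trans (cong (_/ 4) (FinP.toℕ-fromℕ< a<n)) (trans a/4≡b/4 (cong (_/ 4) (sym (FinP.toℕ-fromℕ< b<n)))))
  ... | yes _   | no _    = refl
  ... | no _    | _       = refl

  A-rows : ∀ {a b} (a<n : a < n) (b<n : b < n) →
           sumℤ n (λ l → A a (toℕ l) ℤ.* A b (toℕ l))
           ≡ (if ⌊ fromℕ< a<n Fin.≟ fromℕ< b<n ⌋ then + (4 * (1 + u)) else + 0)
  A-rows a<n b<n = trans (sumℤ-cong n λ l → cong₂ ℤ._*_ (A-at a<n l) (A-at b<n l)) (proj₂ W-weighing _ _)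
    where
    A-at : ∀ {a} (a<n : a < n) l → A a (toℕ l) ≡ W (fromℕ< a<n) l
    A-at a<n l = trans (A-fromℕ< a<n (FinP.toℕ<n l)) (cong (W _) (FinP.fromℕ<-toℕ l (FinP.toℕ<n l)))

  A-norm : ∀ {a} → a < n → sumℤ n (λ l → A a (toℕ l) ℤ.* A a (toℕ l)) ≡ + (4 * (1 + u))
  A-norm a<n with fromℕ< a<n Fin.≟ fromℕ< a<n | A-rows a<n a<n
  ... | yes _ | rows = rows
  ... | no ≢  | _    = ⊥-elim (≢ refl)

  A-orthogonal : ∀ {a b} → a < n → b < n → a ≢ b → sumℤ n (λ l → A a (toℕ l) ℤ.* A b (toℕ l)) ≡ + 0
  A-orthogonal a<n b<n a≢b with fromℕ< a<n Fin.≟ fromℕ< b<n | A-rows a<n b<n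
  ... | yes eq | _    = ⊥-elim (a≢b (trans (sym (FinP.toℕ-fromℕ< a<n)) (trans (cong toℕ eq) (FinP.toℕ-fromℕ< b<n))))
  ... | no _   | rows = rows

  near : ℕ → ℕ → Bool
  near a b = a / 4 ≡ᵇ b / 4

  near-sym : ∀ a b → near a b ≡ near b a
  near-sym a b = ≡ᵇ-sym (a / 4) (b / 4)

  ∑-near : ∀ {a} → a < n → ∑[ l < n ] [ near a l ] ≡ 4
  ∑-near {a} a<n = begin
    ∑[ l < n ] [ near a l ]       ≡⟨ cong (λ m → ∑[ l < m ] [ near a l ]) (*-comm 4 t) ⟩
    ∑[ l < t * 4 ] [ near a l ]   ≡⟨ ∑-block t 4 (m<n*o⇒m/o<n (subst (a <_) (*-comm 4 t) a<n)) ⟩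
    4                              ∎
    where open ≡-Reasoning

  ∑-far : ∀ {a} → a < n → ∑[ l < n ] [ not (near a l) ] ≡ 4 + 4 * u
  ∑-far {a} a<n = +-cancelˡ-≡ 4 _ _ (begin
    4 + ∑[ l < n ] [ not (near a l) ]
        ≡⟨ cong (λ s → s + ∑[ l < n ] [ not (near a l) ]) (sym (∑-near a<n)) ⟩
    ∑[ l < n ] [ near a l ] + ∑[ l < n ] [ not (near a l) ]
        ≡⟨ ∑-complement n (near a) ⟩
    4 * (2 + u)
        ≡⟨ arithmetic u ⟩
    4 + (4 + 4 * u) ∎)
    where
    open ≡-Reasoning
    arithmetic : ∀ u → 4 * (2 + u) ≡ 4 + (4 + 4 * u)
    arithmetic = solve-∀

  nonzero : ℕ → ℕ → Bool
  nonzero a l = not ⌊ A a l ℤ.≟ + 0 ⌋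

  ∑-nonzero : ∀ {a} → a < n → ∑[ l < n ] [ nonzero a l ] ≡ 4 + 4 * u
  ∑-nonzero {a} a<n = ℤP.+-injective (begin
    + ∑[ l < n ] [ nonzero a l ]                      ≡⟨ sym (sumℤ-ℕ n (λ l → [ nonzero a l ])) ⟩
    sumℤ n (λ l → + [ nonzero a (toℕ l) ])            ≡⟨ sumℤ-cong n (λ l → sym (square (toℕ l))) ⟩
    sumℤ n (λ l → A a (toℕ l) ℤ.* A a (toℕ l))       ≡⟨ A-norm a<n ⟩
    + (4 * (1 + u))                                    ≡⟨ cong +_ (arithmetic u) ⟩
    + (4 + 4 * u)                                      ∎)
    where
    open ≡-Reasoning
    arithmetic : ∀ u → 4 * (1 + u) ≡ 4 + 4 * u
    arithmetic = solve-∀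
    square : ∀ l → A a l ℤ.* A a l ≡ + [ nonzero a l ]
    square l with A-entries a l
    ... | inj₁ A≡0         rewrite A≡0  = refl
    ... | inj₂ (inj₁ A≡1)  rewrite A≡1  = refl
    ... | inj₂ (inj₂ A≡-1) rewrite A≡-1 = refl

  nonzero≡far : ∀ {a} → a < n → ∀ l → l < n → [ nonzero a l ] ≡ [ not (near a l) ]
  nonzero≡far {a} a<n = ∑-≤-≡ n nonzero≤far (trans (∑-nonzero a<n) (sym (∑-far a<n)))
    where
    nonzero≤far : ∀ l → l < n → [ nonzero a l ] ≤ [ not (near a l) ]
    nonzero≤far l _ with near a l in near≡
    ... | true  rewrite A-blocks a l (≡ᵇ-true (a / 4) (l / 4) near≡) = z≤n
    ... | false with nonzero a l
    ...   | true  = s≤s z≤n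
    ...   | false = z≤n

  A-offBlock : ∀ {a l} → a < n → l < n → a / 4 ≢ l / 4 → A a l ≡ + 1 ⊎ A a l ≡ -[1+ 0 ]
  A-offBlock {a} {l} a<n l<n a/4≢l/4 with A-entries a l
  ... | inj₂ ±1  = ±1
  ... | inj₁ A≡0 = ⊥-elim (0≢1 (begin
    0                          ≡⟨ cong (λ x → [ not ⌊ x ℤ.≟ + 0 ⌋ ]) (sym A≡0) ⟩
    [ nonzero a l ]            ≡⟨ nonzero≡far a<n l l<n ⟩
    [ not (near a l) ]         ≡⟨ cong (λ b → [ not b ]) (≡ᵇ-false a/4≢l/4) ⟩
    1                          ∎))
    where
    open ≡-Reasoning
    0≢1 : 0 ≢ 1
    0≢1 ()

  link : ℕ → ℕ → Link
  link a b = classify (a ≡ᵇ b) (near a b) (A a b)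

  link-sym : ∀ a b → link a b ≡ link b a
  link-sym a b rewrite ≡ᵇ-sym a b | near-sym a b | A-symmetric a b = refl

  isSelf-link : ∀ a b → isSelf (link a b) ≡ (a ≡ᵇ b)
  isSelf-link a b with a ≡ᵇ b | near a b
  ... | true  | _     = refl
  ... | false | true  = refl
  ... | false | false = refl

  isMate-link : ∀ a b → isMate (link a b) ≡ near a b ∧ not (a ≡ᵇ b)
  isMate-link a b with a ≡ᵇ b | near a b
  ... | true  | near? = sym (∧-zeroʳ near?)
  ... | false | true  = refl
  ... | false | false = refl

  isOff-link : ∀ a b → isOff (link a b) ≡ not (near a b)
  isOff-link a b with a ≡ᵇ b in a≡ᵇb | near a b in near≡
  ... | true  | true  = refl
  ... | true  | false = ⊥-elim (≡ᵇ-false⇒≢ (a / 4) (b / 4) near≡ (cong (_/ 4) (≡ᵇ-true a b a≡ᵇb)))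
  ... | false | true  = refl
  ... | false | false = refl

  link-self : ∀ a → link a a ≡ self
  link-self a rewrite ≡ᵇ-refl a = refl

  link-mate : ∀ {a b} → a ≢ b → a / 4 ≡ b / 4 → link a b ≡ mate
  link-mate {a} {b} a≢b a/4≡b/4 rewrite ≡ᵇ-false a≢b | a/4≡b/4 | ≡ᵇ-refl (b / 4) = refl

  link-off : ∀ {a b} → a / 4 ≢ b / 4 → link a b ≡ off (ℤ.sign (A a b))
  link-off {a} {b} a/4≢b/4 with a ≡ᵇ b in a≡ᵇb | near a b in near≡
  ... | true  | _     = ⊥-elim (a/4≢b/4 (cong (_/ 4) (≡ᵇ-true a b a≡ᵇb)))
  ... | false | true  = ⊥-elim (a/4≢b/4 (≡ᵇ-true (a / 4) (b / 4) near≡))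
  ... | false | false = refl

  A-link : ∀ {a b} → a < n → b < n → A a b ≡ entry (link a b)
  A-link {a} {b} a<n b<n with a ≡ᵇ b in a≡ᵇb | near a b in near≡
  ... | true  | _     = A-blocks a b (cong (_/ 4) (≡ᵇ-true a b a≡ᵇb))
  ... | false | true  = A-blocks a b (≡ᵇ-true (a / 4) (b / 4) near≡)
  ... | false | false = ±1≡sign◃1 (A-offBlock a<n b<n (≡ᵇ-false⇒≢ (a / 4) (b / 4) near≡))
    where
    ±1≡sign◃1 : ∀ {x} → x ≡ + 1 ⊎ x ≡ -[1+ 0 ] → x ≡ ℤ.sign x ◃ 1
    ±1≡sign◃1 (inj₁ refl) = refl
    ±1≡sign◃1 (inj₂ refl) = refl

  -- Counting indices by category

  ∑-self : ∀ {a} (f : ℕ → ℕ) → a < n → ∑[ l < n ] when (isSelf (link a l)) (f l) ≡ f a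
  ∑-self {a} f a<n = trans (∑-cong n λ l _ → cong (λ b → when b (f l)) (isSelf-link a l)) (∑-point f a<n)

  ∑-mates : ∀ {a} → a < n → ∑[ l < n ] [ isMate (link a l) ] ≡ 3
  ∑-mates {a} a<n = +-cancelˡ-≡ 1 _ _ (begin
    1 + ∑[ l < n ] [ isMate (link a l) ]
        ≡⟨ cong₂ _+_ (cong [_] (sym (≡ᵇ-refl (a / 4)))) (∑-cong n λ l _ → cong [_] (isMate-link a l)) ⟩
    [ near a a ] + ∑[ l < n ] [ near a l ∧ not (a ≡ᵇ l) ]  ≡⟨ sym (∑-remove (near a) a<n) ⟩
    ∑[ l < n ] [ near a l ]                                 ≡⟨ ∑-near a<n ⟩
    4                                                        ∎)
    where open ≡-Reasoning

  ∑-off : ∀ {a} → a < n → ∑[ l < n ] [ isOff (link a l) ] ≡ 4 + 4 * u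
  ∑-off {a} a<n = trans (∑-cong n λ l _ → cong [_] (isOff-link a l)) (∑-far a<n)

  pairs : (Link → Link → Bool) → ℕ → ℕ → ℕ
  pairs κ a b = ∑[ l < n ] [ κ (link a l) (link l b) ]

  sameSign≡oppositeSign : ∀ {a b} → a < n → b < n → a ≢ b → pairs sameSign a b ≡ pairs oppositeSign a b
  sameSign≡oppositeSign {a} {b} a<n b<n a≢b = ℤP.+-injective (ℤP.i-j≡0⇒i≡j _ _ (begin
    + pairs sameSign a b ℤ.- + pairs oppositeSign a b
        ≡⟨ sym (sumℤ-ℕ-difference n same opposite) ⟩
    sumℤ n (λ l → + same (toℕ l) ℤ.- + opposite (toℕ l))
        ≡⟨ sumℤ-cong n (λ l → sym (product (FinP.toℕ<n l))) ⟩
    sumℤ n (λ l → A a (toℕ l) ℤ.* A b (toℕ l))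
        ≡⟨ A-orthogonal a<n b<n a≢b ⟩
    + 0 ∎))
    where
    open ≡-Reasoning
    same opposite : ℕ → ℕ
    same     l = [ sameSign (link a l) (link l b) ]
    opposite l = [ oppositeSign (link a l) (link l b) ]
    product : ∀ {l} → l < n → A a l ℤ.* A b l ≡ + same l ℤ.- + opposite l
    product {l} l<n = trans (cong₂ ℤ._*_ (A-link a<n l<n) (trans (A-symmetric b l) (A-link l<n b<n)))
                            (entry-product (link a l) (link l b))

  signed-pairs : ∀ {a b} k → a < n → b < n → a ≢ b → pairs offOff a b ≡ k + k →
                 pairs sameSign a b ≡ k × pairs oppositeSign a b ≡ k
  signed-pairs {a} {b} k a<n b<n a≢b offOff≡ = same≡k , trans (sym same≡opposite) same≡k
    where
    same≡opposite = sameSign≡oppositeSign a<n b<n a≢b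
    same≡k : pairs sameSign a b ≡ k
    same≡k = double-injective (begin
      pairs sameSign a b + pairs sameSign a b      ≡⟨ cong (λ s → pairs sameSign a b + s) same≡opposite ⟩
      pairs sameSign a b + pairs oppositeSign a b
          ≡⟨ sym (∑-distrib-+ n (λ l → [ sameSign (link a l) (link l b) ]) (λ l → [ oppositeSign (link a l) (link l b) ])) ⟩
      ∑[ l < n ] ([ sameSign (link a l) (link l b) ] + [ oppositeSign (link a l) (link l b) ])
          ≡⟨ ∑-cong n (λ l _ → sameSign+oppositeSign (link a l) (link l b)) ⟩
      pairs offOff a b                             ≡⟨ offOff≡ ⟩
      k + k                                        ∎)
      where open ≡-Reasoning

  record Profile (a b : ℕ) (r : Link) : Set where
    field
      #bothMates≡    : pairs bothMates a b ≡ ⟦ #bothMates r ⟧ u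
      #mateOff≡      : pairs mateOff a b ≡ ⟦ #mateOff r ⟧ u
      #offMate≡      : pairs offMate a b ≡ ⟦ #mateOff r ⟧ u
      #sameSign≡     : pairs sameSign a b ≡ ⟦ #sameSign r ⟧ u
      #oppositeSign≡ : pairs oppositeSign a b ≡ ⟦ #oppositeSign r ⟧ u

  profile-self : ∀ {a} → a < n → Profile a a self
  profile-self {a} a<n = record
    { #bothMates≡    = trans (diagonal bothMates (λ r → ∧-idem (isMate r))) (∑-mates a<n)
    ; #mateOff≡      = trans (diagonal mateOff mateOff-diagonal) (∑-zeros n)
    ; #offMate≡      = trans (diagonal offMate mateOff-diagonal) (∑-zeros n)
    ; #sameSign≡     = trans (diagonal sameSign sameSign-diagonal) (∑-off a<n)
    ; #oppositeSign≡ = trans (diagonal oppositeSign oppositeSign-diagonal) (∑-zeros n)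
    }
    where
    diagonal : ∀ κ {g : Link → Bool} → (∀ r → κ r r ≡ g r) → pairs κ a a ≡ ∑[ l < n ] [ g (link a l) ]
    diagonal κ κ≡g = ∑-cong n λ l _ → cong [_] (trans (cong (κ (link a l)) (link-sym l a)) (κ≡g (link a l)))

  near-mates : ∀ a b → a / 4 ≡ b / 4 → ∀ l → near l b ≡ near a l
  near-mates a b a/4≡b/4 l = trans (cong (λ x → l / 4 ≡ᵇ x) (sym a/4≡b/4)) (near-sym l a)

  near-apart : ∀ a b → a / 4 ≢ b / 4 → ∀ l → near a l ∧ near l b ≡ false
  near-apart a b a/4≢b/4 l with near a l in a~l
  ... | true  = ≡ᵇ-false λ l/4≡b/4 → a/4≢b/4 (trans (≡ᵇ-true (a / 4) (l / 4) a~l) l/4≡b/4)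
  ... | false = refl

  bothMates-mates : ∀ {a b} → a < n → b < n → a ≢ b → a / 4 ≡ b / 4 → pairs bothMates a b ≡ 2
  bothMates-mates {a} {b} a<n b<n a≢b a/4≡b/4 = +-cancelˡ-≡ 1 _ _ (begin
    1 + pairs bothMates a b
        ≡⟨ cong₂ _+_ (cong [_] (sym isMate-ab)) (∑-cong n λ l _ → cong [_] (pointwise l)) ⟩
    [ isMate (link a b) ] + ∑[ l < n ] [ isMate (link a l) ∧ not (b ≡ᵇ l) ]
        ≡⟨ sym (∑-remove (λ l → isMate (link a l)) b<n) ⟩
    ∑[ l < n ] [ isMate (link a l) ]
        ≡⟨ ∑-mates a<n ⟩
    3   ∎)
    where
    open ≡-Reasoning
    isMate-ab : isMate (link a b) ≡ true
    isMate-ab = trans (isMate-link a b)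
      (cong₂ (λ x y → x ∧ not y) (trans (cong (λ x → a / 4 ≡ᵇ x) (sym a/4≡b/4)) (≡ᵇ-refl (a / 4))) (≡ᵇ-false a≢b))
    pointwise : ∀ l → bothMates (link a l) (link l b) ≡ isMate (link a l) ∧ not (b ≡ᵇ l)
    pointwise l = begin
      isMate (link a l) ∧ isMate (link l b)
          ≡⟨ cong₂ _∧_ (isMate-link a l)
                       (trans (isMate-link l b) (cong₂ (λ x y → x ∧ not y) (near-mates a b a/4≡b/4 l) (≡ᵇ-sym l b))) ⟩
      (near a l ∧ not (a ≡ᵇ l)) ∧ (near a l ∧ not (b ≡ᵇ l))
          ≡⟨ ∧-shared (near a l) _ _ ⟩
      (near a l ∧ not (a ≡ᵇ l)) ∧ not (b ≡ᵇ l)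
          ≡⟨ cong (λ x → x ∧ not (b ≡ᵇ l)) (sym (isMate-link a l)) ⟩
      isMate (link a l) ∧ not (b ≡ᵇ l) ∎

  profile-mates : ∀ {a b} → a < n → b < n → a ≢ b → a / 4 ≡ b / 4 → Profile a b mate
  profile-mates {a} {b} a<n b<n a≢b a/4≡b/4 = record
    { #bothMates≡    = bothMates-mates a<n b<n a≢b a/4≡b/4
    ; #mateOff≡      = ∑-false n λ l → mateOff-sameOff (link a l) (link l b) (isOff-b l)
    ; #offMate≡      = ∑-false n λ l → mateOff-sameOff (link l b) (link a l) (sym (isOff-b l))
    ; #sameSign≡     = proj₁ signs
    ; #oppositeSign≡ = proj₂ signs
    }
    where
    open ≡-Reasoning
    isOff-b : ∀ l → isOff (link l b) ≡ isOff (link a l)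
    isOff-b l = trans (isOff-link l b) (trans (cong not (near-mates a b a/4≡b/4 l)) (sym (isOff-link a l)))
    mateOff-sameOff : ∀ r₁ r₂ → isOff r₂ ≡ isOff r₁ → mateOff r₁ r₂ ≡ false
    mateOff-sameOff r₁ r₂ off≡ = trans (cong (λ x → isMate r₁ ∧ x) off≡) (mateOff-diagonal r₁)
    signs = signed-pairs (2 + 2 * u) a<n b<n a≢b (begin
      pairs offOff a b                    ≡⟨ ∑-cong n (λ l _ → cong (λ x → [ isOff (link a l) ∧ x ]) (isOff-b l)) ⟩
      ∑[ l < n ] [ isOff (link a l) ∧ isOff (link a l) ]
                                          ≡⟨ ∑-cong n (λ l _ → cong [_] (∧-idem (isOff (link a l)))) ⟩
      ∑[ l < n ] [ isOff (link a l) ]    ≡⟨ ∑-off a<n ⟩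
      4 + 4 * u                           ≡⟨ arithmetic u ⟩
      (2 + 2 * u) + (2 + 2 * u)           ∎)
      where
      arithmetic : ∀ u → 4 + 4 * u ≡ (2 + 2 * u) + (2 + 2 * u)
      arithmetic = solve-∀

  offOff-far : ∀ {a b} → a < n → b < n → a / 4 ≢ b / 4 → pairs offOff a b ≡ 4 * u
  offOff-far {a} {b} a<n b<n a/4≢b/4 = +-cancelˡ-≡ 4 _ _ (begin
    4 + pairs offOff a b
        ≡⟨ cong₂ _+_ (sym (trans (∑-cong n λ l _ → cong [_] (near-sym l b)) (∑-near b<n)))
                     (∑-cong n λ l _ → cong [_] (cong₂ _∧_ (isOff-link a l) (isOff-link l b))) ⟩
    ∑[ l < n ] [ near l b ] + ∑[ l < n ] [ not (near a l) ∧ not (near l b) ]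
        ≡⟨ cong (λ s → s + ∑[ l < n ] [ not (near a l) ∧ not (near l b) ])
                (∑-cong n λ l _ → cong [_] (sym (not-∧-disjoint (near a l) (near l b) (near-apart a b a/4≢b/4 l)))) ⟩
    ∑[ l < n ] [ not (near a l) ∧ near l b ] + ∑[ l < n ] [ not (near a l) ∧ not (near l b) ]
        ≡⟨ sym (∑-split n (λ l → not (near a l)) (λ l → near l b)) ⟩
    ∑[ l < n ] [ not (near a l) ]
        ≡⟨ ∑-far a<n ⟩
    4 + 4 * u ∎)
    where open ≡-Reasoning

  profile-far : ∀ {a b} σ → a < n → b < n → a / 4 ≢ b / 4 → Profile a b (off σ)
  profile-far {a} {b} _ a<n b<n a/4≢b/4 = record
    { #bothMates≡    = ∑-false n λ l → begin
        isMate (link a l) ∧ isMate (link l b)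
            ≡⟨ cong₂ _∧_ (isMate-link a l) (isMate-link l b) ⟩
        (near a l ∧ not (a ≡ᵇ l)) ∧ (near l b ∧ not (l ≡ᵇ b))
            ≡⟨ ∧-disjoint (near a l) (near l b) _ _ (apart l) ⟩
        false ∎
    ; #mateOff≡      = trans (∑-cong n λ l _ → cong [_] (begin
        isMate (link a l) ∧ isOff (link l b)
            ≡⟨ cong₂ _∧_ (isMate-link a l) (isOff-link l b) ⟩
        (near a l ∧ not (a ≡ᵇ l)) ∧ not (near l b)
            ≡⟨ ∧-not-disjoint (near a l) (near l b) _ (apart l) ⟩
        near a l ∧ not (a ≡ᵇ l)
            ≡⟨ sym (isMate-link a l) ⟩
        isMate (link a l) ∎)) (∑-mates a<n)
    ; #offMate≡      = trans (∑-cong n λ l _ → cong [_] (begin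
        isMate (link l b) ∧ isOff (link a l)
            ≡⟨ cong₂ _∧_ (isMate-link l b) (isOff-link a l) ⟩
        (near l b ∧ not (l ≡ᵇ b)) ∧ not (near a l)
            ≡⟨ ∧-not-disjoint (near l b) (near a l) _ (trans (∧-comm (near l b) (near a l)) (apart l)) ⟩
        near l b ∧ not (l ≡ᵇ b)
            ≡⟨ sym (isMate-link l b) ⟩
        isMate (link l b)
            ≡⟨ cong isMate (link-sym l b) ⟩
        isMate (link b l) ∎)) (∑-mates b<n)
    ; #sameSign≡     = proj₁ signs
    ; #oppositeSign≡ = proj₂ signs
    }
    where
    open ≡-Reasoning
    apart = near-apart a b a/4≢b/4
    signs = signed-pairs (2 * u) a<n b<n (λ a≡b → a/4≢b/4 (cong (_/ 4) a≡b))
              (trans (offOff-far a<n b<n a/4≢b/4) (arithmetic u))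
      where
      arithmetic : ∀ u → 4 * u ≡ 2 * u + 2 * u
      arithmetic = solve-∀

  profile : ∀ {a b} → a < n → b < n → Profile a b (link a b)
  profile {a} {b} a<n b<n with a ≟ b
  ... | yes refl = subst (Profile a a) (sym (link-self a)) (profile-self a<n)
  ... | no a≢b with a / 4 ≟ b / 4
  ...   | yes a/4≡b/4 = subst (Profile a b) (sym (link-mate a≢b a/4≡b/4)) (profile-mates a<n b<n a≢b a/4≡b/4)
  ...   | no a/4≢b/4  = subst (Profile a b) (sym (link-off {a} {b} a/4≢b/4)) (profile-far _ a<n b<n a/4≢b/4)

  ∑-other : ∀ a {b} (f : ℕ → ℕ) → b < n →
            ∑[ l < n ] when (isSelf (link l b) ∧ not (isSelf (link a l))) (f l)
            ≡ when (not (isSelf (link a b))) (f b)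
  ∑-other a {b} f b<n =
    trans (∑-cong n λ l _ → trans (cong (λ x → when (x ∧ not (isSelf (link a l))) (f l))
                                        (trans (isSelf-link l b) (≡ᵇ-sym l b)))
                                  (when-∧ (b ≡ᵇ l) _ _))
          (∑-point (λ l → when (not (isSelf (link a l))) (f l)) b<n)

  ∑-category : ∀ κ a b k {m} → pairs κ a b ≡ m → ∑[ l < n ] when (κ (link a l) (link l b)) k ≡ k * m
  ∑-category κ a b k pairs≡m = trans (∑-when n (λ l → κ (link a l) (link l b)) k) (cong (k *_) pairs≡m)

  ∑-over-indices : ∀ F → FlipInvariant F → ∀ {a b} → a < n → b < n →
                   ∑[ l < n ] F (link a l) (link l b) ≡ ⟦ indexCount F (link a b) ⟧ u
  ∑-over-indices F F-flip {a} {b} a<n b<n = begin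
    ∑[ l < n ] F (link a l) (link l b)
        ≡⟨ ∑-cong n (λ l _ → decompose F F-flip (link a l) (link l b)) ⟩
    ∑[ l < n ] (atA l + from-atB l)
        ≡⟨ split atA from-atB (split atB from-mm (split mm from-mo (split mo from-om (split om from-ss (∑-distrib-+ n ss os))))) ⟩
    ∑ n atA + (∑ n atB + (∑ n mm + (∑ n mo + (∑ n om + (∑ n ss + ∑ n os)))))
        ≡⟨ cong₂ _+_ (∑-self (λ l → F self (link l b)) a<n) (cong₂ _+_ (∑-other a (λ l → F (link a l) self) b<n)
             (cong₂ _+_ (∑-category bothMates a b _ #bothMates≡) (cong₂ _+_ (∑-category mateOff a b _ #mateOff≡)
             (cong₂ _+_ (∑-category offMate a b _ #offMate≡) (cong₂ _+_ (∑-category sameSign a b _ #sameSign≡)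
             (∑-category oppositeSign a b _ #oppositeSign≡)))))) ⟩
    F self r + (when (not (isSelf r)) (F r self)
      + (F mate mate * ⟦ #bothMates r ⟧ u
      + (F mate (off Sign.+) * ⟦ #mateOff r ⟧ u
      + (F (off Sign.+) mate * ⟦ #mateOff r ⟧ u
      + (F (off Sign.+) (off Sign.+) * ⟦ #sameSign r ⟧ u
      +  F (off Sign.+) (off Sign.-) * ⟦ #oppositeSign r ⟧ u)))))
        ≡⟨ sym (⟦indexCount⟧ F r u) ⟩
    ⟦ indexCount F r ⟧ u ∎
    where
    open ≡-Reasoning
    open Profile (profile a<n b<n)
    r = link a b
    atA atB mm mo om ss os : ℕ → ℕ
    atA l = when (isSelf (link a l)) (F self (link l b))
    atB l = when (isSelf (link l b) ∧ not (isSelf (link a l))) (F (link a l) self)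
    mm  l = when (bothMates (link a l) (link l b)) (F mate mate)
    mo  l = when (mateOff (link a l) (link l b)) (F mate (off Sign.+))
    om  l = when (offMate (link a l) (link l b)) (F (off Sign.+) mate)
    ss  l = when (sameSign (link a l) (link l b)) (F (off Sign.+) (off Sign.+))
    os  l = when (oppositeSign (link a l) (link l b)) (F (off Sign.+) (off Sign.-))
    from-atB from-mm from-mo from-om from-ss : ℕ → ℕ
    from-atB l = atB l + from-mm l
    from-mm  l = mm l + from-mo l
    from-mo  l = mo l + from-om l
    from-om  l = om l + from-ss l
    from-ss  l = ss l + os l
    split : ∀ f g {s} → ∑ n g ≡ s → ∑[ l < n ] (f l + g l) ≡ ∑ n f + s
    split f g ∑g≡s = trans (∑-distrib-+ n f g) (cong (λ s → ∑ n f + s) ∑g≡s)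

  N : ℕ
  N = 8 * t

  N≡n*2 : N ≡ n * 2
  N≡n*2 = arithmetic u
    where
    arithmetic : ∀ u → 8 * (2 + u) ≡ 4 * (2 + u) * 2
    arithmetic = solve-∀

  half< : ∀ {X} → X < N → X / 2 < n
  half< {X} X<N = m<n*o⇒m/o<n (subst (X <_) N≡n*2 X<N)

  vcolour : ℕ → ℕ → Fin 5
  vcolour X Y = colour (link (X / 2) (Y / 2)) (X % 2 ≡ᵇ Y % 2)

  even : ℕ → Bool
  even X = X % 2 ≡ᵇ 0

  parity-bits : ∀ X → (X % 2 ≡ᵇ 1) ≡ not (even X) × (0 ≡ᵇ X % 2) ≡ even X × (1 ≡ᵇ X % 2) ≡ not (even X)
  parity-bits X with X % 2 | m%n<n X 2
  ... | 0           | _            = refl , refl , refl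
  ... | 1           | _            = refl , refl , refl
  ... | suc (suc _) | s≤s (s≤s ())

  sameParity : ∀ X Y → (X % 2 ≡ᵇ Y % 2) ≡ not (even X xor even Y)
  sameParity X Y with X % 2 | m%n<n X 2 | Y % 2 | m%n<n Y 2
  ... | 0           | _            | 0           | _            = refl
  ... | 0           | _            | 1           | _            = refl
  ... | 1           | _            | 0           | _            = refl
  ... | 1           | _            | 1           | _            = refl
  ... | suc (suc _) | s≤s (s≤s ()) | _           | _
  ... | _           | _            | suc (suc _) | s≤s (s≤s ())

  vcolour-to : ∀ X l {h} → h < 2 → vcolour X (l * 2 + h) ≡ colour (link (X / 2) l) (X % 2 ≡ᵇ h)
  vcolour-to X l h<2 = cong₂ (λ k j → colour (link (X / 2) k) (X % 2 ≡ᵇ j)) ([m*q+j]/q≡m l 2 h<2) ([m*q+j]%q≡j l 2 h<2)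

  vcolour-from : ∀ l Y {h} → h < 2 → vcolour (l * 2 + h) Y ≡ colour (link l (Y / 2)) (h ≡ᵇ Y % 2)
  vcolour-from l Y h<2 = cong₂ (λ k j → colour (link k (Y / 2)) (j ≡ᵇ Y % 2)) ([m*q+j]/q≡m l 2 h<2) ([m*q+j]%q≡j l 2 h<2)

  ∑-over-vertices : ∀ P {X Y} → X < N → Y < N →
    ∑[ Z < N ] [ P (vcolour X Z) (vcolour Z Y) ] ≡ ⟦ pairCount P (link (X / 2) (Y / 2)) (even X) (even Y) ⟧ u
  ∑-over-vertices P {X} {Y} X<N Y<N = begin
    ∑ N f                                      ≡⟨ cong (λ m → ∑ m f) N≡n*2 ⟩
    ∑ (n * 2) f                                ≡⟨ ∑-* n 2 f ⟩
    ∑[ l < n ] ∑[ h < 2 ] f (l * 2 + h)       ≡⟨ ∑-cong n (λ l _ → over-l l) ⟩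
    ∑[ l < n ] overIndex P (even X) (even Y) (link (X / 2) l) (link l (Y / 2))
        ≡⟨ ∑-over-indices _ (overIndex-flipInvariant P (even X) (even Y)) (half< X<N) (half< Y<N) ⟩
    ⟦ pairCount P (link (X / 2) (Y / 2)) (even X) (even Y) ⟧ u ∎
    where
    open ≡-Reasoning
    f : ℕ → ℕ
    f Z = [ P (vcolour X Z) (vcolour Z Y) ]
    over-l : ∀ l → ∑[ h < 2 ] f (l * 2 + h) ≡ overIndex P (even X) (even Y) (link (X / 2) l) (link l (Y / 2))
    over-l l = cong₂ _+_
      (cong₂ (λ γ δ → [ P γ δ ])
        (vcolour-to X l (s≤s z≤n))
        (trans (vcolour-from l Y (s≤s z≤n)) (cong (colour (link l (Y / 2))) (proj₁ (proj₂ (parity-bits Y))))))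
      (trans (+-identityʳ _) (cong₂ (λ γ δ → [ P γ δ ])
        (trans (vcolour-to X l (s≤s (s≤s z≤n))) (cong (colour (link (X / 2) l)) (proj₁ (parity-bits X))))
        (trans (vcolour-from l Y (s≤s (s≤s z≤n))) (cong (colour (link l (Y / 2))) (proj₂ (proj₂ (parity-bits Y)))))))

  c : Fin N → Fin N → Fin 5
  c x y = vcolour (toℕ x) (toℕ y)

  count-pairs : ∀ P → ColourDetermined P → ∀ x y → count N (λ z → P (c x z) (c z y)) ≡ ⟦ intersection P (c x y) ⟧ u
  count-pairs P determined x y = begin
    count N (λ z → P (c x z) (c z y))
        ≡⟨ count-∑ N (λ Z → P (vcolour X Z) (vcolour Z Y)) ⟩
    ∑[ Z < N ] [ P (vcolour X Z) (vcolour Z Y) ]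
        ≡⟨ ∑-over-vertices P (FinP.toℕ<n x) (FinP.toℕ<n y) ⟩
    ⟦ pairCount P (link (X / 2) (Y / 2)) (even X) (even Y) ⟧ u
        ≡⟨ cong (λ p → ⟦ p ⟧ u) (determined (link (X / 2) (Y / 2)) (even X) (even Y)) ⟩
    ⟦ intersection P (colour (link (X / 2) (Y / 2)) (not (even X xor even Y))) ⟧ u
        ≡⟨ cong (λ p → ⟦ intersection P (colour (link (X / 2) (Y / 2)) p) ⟧ u) (sym (sameParity X Y)) ⟩
    ⟦ intersection P (c x y) ⟧ u ∎
    where
    open ≡-Reasoning
    X = toℕ x
    Y = toℕ y

  c-sym : ∀ x y → c x y ≡ c y x
  c-sym x y = cong₂ colour (link-sym (toℕ x / 2) (toℕ y / 2)) (≡ᵇ-sym (toℕ x % 2) (toℕ y % 2))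

  c-refl : ∀ x → c x x ≡ 0F
  c-refl x rewrite link-self (toℕ x / 2) | ≡ᵇ-refl (toℕ x % 2) = refl

  c-diagonal : ∀ x y → (c x y ≡ 0F) ⇔ (x ≡ y)
  c-diagonal x y = mk⇔ (λ c≡0 → FinP.toℕ-injective (≡ᵇ-true X Y (begin
      X ≡ᵇ Y
          ≡⟨ ≡ᵇ-by-divMod X Y 2 ⟩
      (X / 2 ≡ᵇ Y / 2) ∧ (X % 2 ≡ᵇ Y % 2)
          ≡⟨ cong (λ s → s ∧ (X % 2 ≡ᵇ Y % 2)) (sym (isSelf-link (X / 2) (Y / 2))) ⟩
      isSelf (link (X / 2) (Y / 2)) ∧ (X % 2 ≡ᵇ Y % 2)
          ≡⟨ colour-diagonal (link (X / 2) (Y / 2)) (X % 2 ≡ᵇ Y % 2) c≡0 ⟩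
      true ∎)))
    λ { refl → c-refl x }
    where
    open ≡-Reasoning
    X = toℕ x
    Y = toℕ y

  c-fibre : ∀ x y → (c x y ≡ 0F ⊎ c x y ≡ 1F) ⇔ (toℕ x / 2 ≡ toℕ y / 2)
  c-fibre x y = mk⇔
    (λ c∈01 → ≡ᵇ-true a b (trans (sym (isSelf-link a b)) (colour-fibre (link a b) p c∈01)))
    (λ a≡b → subst (λ r → colour r p ≡ 0F ⊎ colour r p ≡ 1F)
                   (trans (sym (link-self a)) (cong (link a) a≡b)) (colour-self p))
    where
    a = toℕ x / 2
    b = toℕ y / 2
    p = toℕ x % 2 ≡ᵇ toℕ y % 2

  c-block : ∀ x y → (c x y ≡ 0F ⊎ c x y ≡ 1F ⊎ c x y ≡ 2F) ⇔ (toℕ x / 2 / 4 ≡ toℕ y / 2 / 4)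
  c-block x y = mk⇔
    (λ c∈012 → ≡ᵇ-true (a / 4) (b / 4) (trans (sym (not-involutive (near a b)))
                 (cong not (trans (sym (isOff-link a b)) (colour-block (link a b) p c∈012)))))
    (λ a/4≡b/4 → colour-notOff (link a b) p (trans (isOff-link a b) (cong not (≡ᵇ-true⁻¹ a/4≡b/4))))
    where
    a = toℕ x / 2
    b = toℕ y / 2
    p = toℕ x % 2 ≡ᵇ toℕ y % 2
    ≡ᵇ-true⁻¹ : ∀ {m n} → m ≡ n → (m ≡ᵇ n) ≡ true
    ≡ᵇ-true⁻¹ {m} refl = ≡ᵇ-refl m

  M-entry : ∀ j {X Y} → X < N → Y < N → M t W j X Y ≡ 𝟙 ⌊ vcolour X Y Fin.≟ j ⌋
  M-entry 0F {X} {Y} _ _ = begin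
    𝟙 (X ≡ᵇ Y)
        ≡⟨ cong 𝟙 (≡ᵇ-by-divMod X Y 2) ⟩
    𝟙 ((X / 2 ≡ᵇ Y / 2) ∧ (X % 2 ≡ᵇ Y % 2))
        ≡⟨ cong (λ s → 𝟙 (s ∧ (X % 2 ≡ᵇ Y % 2))) (sym (isSelf-link (X / 2) (Y / 2))) ⟩
    𝟙 (isSelf (link (X / 2) (Y / 2)) ∧ (X % 2 ≡ᵇ Y % 2))
        ≡⟨ 𝟙-colour₀ (link (X / 2) (Y / 2)) (X % 2 ≡ᵇ Y % 2) ⟩
    𝟙 ⌊ vcolour X Y Fin.≟ 0F ⌋ ∎
    where open ≡-Reasoning
  M-entry 1F {X} {Y} _ _ =
    trans (cong (λ s → 𝟙 s ℤ.* (+ 1 ℤ.- 𝟙 (X % 2 ≡ᵇ Y % 2))) (sym (isSelf-link (X / 2) (Y / 2))))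
          (𝟙-colour₁ (link (X / 2) (Y / 2)) (X % 2 ≡ᵇ Y % 2))
  M-entry 2F {X} {Y} _ _ = begin
    𝟙 (X / 8 ≡ᵇ Y / 8) ℤ.* ((+ 1 ℤ.- 𝟙 (X % 8 / 2 ≡ᵇ Y % 8 / 2)) ℤ.* + 1)
        ≡⟨ cong₂ (λ s m → 𝟙 s ℤ.* ((+ 1 ℤ.- 𝟙 m) ℤ.* + 1))
                 (cong₂ _≡ᵇ_ (sym (m/n/o≡m/[n*o] X 2 4)) (sym (m/n/o≡m/[n*o] Y 2 4)))
                 (cong₂ _≡ᵇ_ (m%[n*o]/o≡m/o%n X 4 2) (m%[n*o]/o≡m/o%n Y 4 2)) ⟩
    𝟙 (near a b) ℤ.* ((+ 1 ℤ.- 𝟙 (a % 4 ≡ᵇ b % 4)) ℤ.* + 1)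
        ≡⟨ block-indicator (near a b) (a % 4 ≡ᵇ b % 4) ⟩
    𝟙 (near a b ∧ not (near a b ∧ (a % 4 ≡ᵇ b % 4)))
        ≡⟨ cong (λ s → 𝟙 (near a b ∧ not s)) (sym (≡ᵇ-by-divMod a b 4)) ⟩
    𝟙 (near a b ∧ not (a ≡ᵇ b))
        ≡⟨ cong 𝟙 (sym (isMate-link a b)) ⟩
    𝟙 (isMate (link a b))
        ≡⟨ 𝟙-colour₂ (link a b) (X % 2 ≡ᵇ Y % 2) ⟩
    𝟙 ⌊ vcolour X Y Fin.≟ 2F ⌋ ∎
    where
    open ≡-Reasoning
    a = X / 2
    b = Y / 2
    block-indicator : ∀ x y → 𝟙 x ℤ.* ((+ 1 ℤ.- 𝟙 y) ℤ.* + 1) ≡ 𝟙 (x ∧ not (x ∧ y))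
    block-indicator true  true  = refl
    block-indicator true  false = refl
    block-indicator false _     = refl
  M-entry 3F {X} {Y} X<N Y<N =
    trans (cong (λ z → block z (X % 2) (Y % 2)) (A-link (half< X<N) (half< Y<N)))
          (𝟙-colour₃ (link (X / 2) (Y / 2)) (X % 2) (Y % 2))
  M-entry 4F {X} {Y} X<N Y<N =
    trans (cong₂ ℤ._-_ (cong₂ ℤ._-_ (cong₂ ℤ._-_ (cong (λ z → + 1 ℤ.- z) (M-entry 0F X<N Y<N))
                                                 (M-entry 1F X<N Y<N))
                                   (M-entry 2F X<N Y<N))
                       (M-entry 3F X<N Y<N))
          (𝟙-colour₄ (vcolour X Y))

  Gamma-adjacent : ∀ i x y → Gamma t W i x y ≡ adjacent i (c x y)
  Gamma-adjacent i x y = cong₂ _∨_ (is-colour 2F) (is-colour i)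
    where
    is-colour : ∀ j → ⌊ M t W j (toℕ x) (toℕ y) ℤ.≟ + 1 ⌋ ≡ ⌊ c x y Fin.≟ j ⌋
    is-colour j = trans (cong (λ z → ⌊ z ℤ.≟ + 1 ⌋) (M-entry j (FinP.toℕ<n x) (FinP.toℕ<n y))) (⌊𝟙≟1⌋ _)

  -- The scheme and the graphs

  interNum-c : ∀ x y α β → interNum c x y α β ≡ ⟦ intersection (isPair α β) (c x y) ⟧ u
  interNum-c x y α β = count-pairs (isPair α β) (isPair-colourDetermined α β) x y

  valency : ∀ x α → valencyAt c x α ≡ ⟦ intersection (isPair α α) 0F ⟧ u
  valency x α = trans (valencyAt≡interNum c c-sym x α)
    (trans (interNum-c x x α α) (cong (λ γ → ⟦ intersection (isPair α α) γ ⟧ u) (c-refl x)))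

  n₁ : ∀ x → valencyAt c x 1F ≡ 1
  n₁ x = valency x 1F

  n₂ : ∀ x → valencyAt c x 2F ≡ 6
  n₂ x = valency x 2F

  n₃ : ∀ x → valencyAt c x 3F ≡ 4 + 4 * u
  n₃ x = valency x 3F

  n₄ : ∀ x → valencyAt c x 4F ≡ 4 + 4 * u
  n₄ x = valency x 4F

  common-Gamma : ∀ i x y → common N (Gamma t W i) x y ≡ ⟦ intersection (bothAdjacent i) (c x y) ⟧ u
  common-Gamma i x y = trans
    (count-cong N λ z → cong₂ _∧_ (Gamma-adjacent i x z) (trans (Gamma-adjacent i y z) (cong (adjacent i) (c-sym y z))))
    (count-pairs (bothAdjacent i) (bothAdjacent-colourDetermined i) x y)

  realised : ∀ X Y → T (X ℕ.<ᵇ 16) → T (Y ℕ.<ᵇ 16) → ∃₂ λ x y → c x y ≡ vcolour X Y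
  realised X Y X<16 Y<16 = vertex (<ᵇ⇒< X 16 X<16) , vertex (<ᵇ⇒< Y 16 Y<16)
                         , cong₂ vcolour (toℕ-vertex (<ᵇ⇒< X 16 X<16)) (toℕ-vertex (<ᵇ⇒< Y 16 Y<16))
    where
    16≤N : 16 ≤ N
    16≤N = subst (16 ≤_) (sym (arithmetic u)) (m≤m+n 16 (8 * u))
      where
      arithmetic : ∀ u → 8 * (2 + u) ≡ 16 + 8 * u
      arithmetic = solve-∀
    vertex : ∀ {k} → k < 16 → Fin N
    vertex k<16 = fromℕ< (≤-trans k<16 16≤N)
    toℕ-vertex : ∀ {k} (k<16 : k < 16) → toℕ (vertex k<16) ≡ k
    toℕ-vertex k<16 = FinP.toℕ-fromℕ< (≤-trans k<16 16≤N)

  -- Indices 0 and 4 lie in different blocks, so the pairs of vertices 0, 8 and 0, 9 have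
  -- colours 3 and 4 in some order.
  realised-off : ∀ p → ∃₂ λ x y → c x y ≡ colour (off (ℤ.sign (A 0 4))) p
  realised-off true  = realised 0 8 _ _
  realised-off false = realised 0 9 _ _

  off-colour : ∀ α → α ≡ 3F ⊎ α ≡ 4F → ∃₂ λ x y → c x y ≡ α
  off-colour α α∈34 with colour-off-onto (ℤ.sign (A 0 4)) α α∈34
  ... | p , colour≡α with realised-off p
  ...   | x , y , c≡colour = x , y , trans c≡colour colour≡α

  colours-occur : ∀ α → ∃₂ λ x y → c x y ≡ α
  colours-occur 0F = realised 0 0 _ _
  colours-occur 1F = realised 0 1 _ _
  colours-occur 2F = realised 0 2 _ _
  colours-occur 3F = off-colour 3F (inj₁ refl)
  colours-occur 4F = off-colour 4F (inj₂ refl)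


  scheme : IsScheme N 5 c
  scheme = colours-occur , (0F , c-diagonal) , ((λ γ → γ) , λ x y → c-sym y x) , well-defined
    where
    well-defined : ∀ α β x y x' y' → c x y ≡ c x' y' → interNum c x y α β ≡ interNum c x' y' α β
    well-defined α β x y x' y' c≡c' = begin
      interNum c x y α β                          ≡⟨ interNum-c x y α β ⟩
      ⟦ intersection (isPair α β) (c x y) ⟧ u     ≡⟨ cong (λ γ → ⟦ intersection (isPair α β) γ ⟧ u) c≡c' ⟩
      ⟦ intersection (isPair α β) (c x' y') ⟧ u   ≡⟨ sym (interNum-c x' y' α β) ⟩
      interNum c x' y' α β                        ∎
      where open ≡-Reasoning

  ⟦⟧-< : ∀ a b a' b' → a < a' → b ≤ b' → ⟦ a , b ⟧ u < ⟦ a' , b' ⟧ u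
  ⟦⟧-< a b a' b' a<a' b≤b' = +-mono-<-≤ a<a' (*-monoˡ-≤ u b≤b')

  selfIntersection<valency : ∀ α γ → α ≡ 3F ⊎ α ≡ 4F → γ ≢ 0F →
             ⟦ intersection (isPair α α) γ ⟧ u < ⟦ intersection (isPair α α) 0F ⟧ u
  selfIntersection<valency _ 0F _           γ≢0 = ⊥-elim (γ≢0 refl)
  selfIntersection<valency _ 1F (inj₁ refl) _   = ⟦⟧-< 0 0 4 4 (s≤s z≤n) z≤n
  selfIntersection<valency _ 2F (inj₁ refl) _   = ⟦⟧-< 2 2 4 4 (s≤s (s≤s (s≤s z≤n))) (s≤s (s≤s z≤n))
  selfIntersection<valency _ 3F (inj₁ refl) _   = ⟦⟧-< 0 2 4 4 (s≤s z≤n) (s≤s (s≤s z≤n))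
  selfIntersection<valency _ 4F (inj₁ refl) _   = ⟦⟧-< 0 2 4 4 (s≤s z≤n) (s≤s (s≤s z≤n))
  selfIntersection<valency _ 1F (inj₂ refl) _   = ⟦⟧-< 0 0 4 4 (s≤s z≤n) z≤n
  selfIntersection<valency _ 2F (inj₂ refl) _   = ⟦⟧-< 2 2 4 4 (s≤s (s≤s (s≤s z≤n))) (s≤s (s≤s z≤n))
  selfIntersection<valency _ 3F (inj₂ refl) _   = ⟦⟧-< 0 2 4 4 (s≤s z≤n) (s≤s (s≤s z≤n))
  selfIntersection<valency _ 4F (inj₂ refl) _   = ⟦⟧-< 0 2 4 4 (s≤s z≤n) (s≤s (s≤s z≤n))

  interNum≢valency : ∀ α → α ≡ 3F ⊎ α ≡ 4F → ∀ x y → x ≢ y → interNum c x y α α ≢ valencyAt c x α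
  interNum≢valency α α∈34 x y x≢y interNum≡valency =
    <-irrefl (trans (sym (interNum-c x y α α)) (trans interNum≡valency (valency x α)))
             (selfIntersection<valency α (c x y) α∈34 λ c≡0 → x≢y (Equivalence.to (c-diagonal x y) c≡0))

  higmanian : IsStdHigmanian N c
  higmanian = scheme , c-sym , c-diagonal
            , kernel-isEquivalence (λ x → toℕ x / 2) c-fibre
            , kernel-isEquivalence (λ x → toℕ x / 2 / 4) c-block
            , radical-trivial c 3F c-sym (interNum≢valency 3F (inj₁ refl))
            , radical-trivial c 4F c-sym (interNum≢valency 4F (inj₂ refl))
            , λ x → ≤-reflexive (trans (n₃ x) (sym (n₄ x)))

  c₃₃³≡c₃₃⁴ : ∀ x y x' y' → c x y ≡ 3F → c x' y' ≡ 4F → interNum c x y 3F 3F ≡ interNum c x' y' 3F 3F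
  c₃₃³≡c₃₃⁴ x y x' y' c≡3 c'≡4 = begin
    interNum c x y 3F 3F                          ≡⟨ interNum-c x y 3F 3F ⟩
    ⟦ intersection (isPair 3F 3F) (c x y) ⟧ u     ≡⟨ cong (λ γ → ⟦ intersection (isPair 3F 3F) γ ⟧ u) c≡3 ⟩
    ⟦ intersection (isPair 3F 3F) 3F ⟧ u          ≡⟨⟩
    ⟦ intersection (isPair 3F 3F) 4F ⟧ u          ≡⟨ cong (λ γ → ⟦ intersection (isPair 3F 3F) γ ⟧ u) (sym c'≡4) ⟩
    ⟦ intersection (isPair 3F 3F) (c x' y') ⟧ u   ≡⟨ sym (interNum-c x' y' 3F 3F) ⟩
    interNum c x' y' 3F 3F                        ∎
    where open ≡-Reasoning

  K2-valencies : ∀ {i j} → (∀ x → valencyAt c x i ≡ 4 + 4 * u) → (∀ x → valencyAt c x j ≡ 4 + 4 * u) →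
    ∀ x → valencyAt c x 2F * valencyAt c x j
          ≡ suc (valencyAt c x 1F) * valencyAt c x j + 2 * valencyAt c x i * suc (valencyAt c x 1F)
  K2-valencies {i} {j} nᵢ nⱼ x = begin
    valencyAt c x 2F * valencyAt c x j
        ≡⟨ cong₂ _*_ (n₂ x) (nⱼ x) ⟩
    6 * (4 + 4 * u)
        ≡⟨ arithmetic (4 + 4 * u) ⟩
    2 * (4 + 4 * u) + 2 * (4 + 4 * u) * 2
        ≡⟨ sym (cong₂ _+_ (cong₂ _*_ (cong suc (n₁ x)) (nⱼ x))
                          (cong₂ _*_ (cong (λ v → 2 * v) (nᵢ x)) (cong suc (n₁ x)))) ⟩
    suc (valencyAt c x 1F) * valencyAt c x j + 2 * valencyAt c x i * suc (valencyAt c x 1F) ∎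
    where
    open ≡-Reasoning
    arithmetic : ∀ v → 6 * v ≡ 2 * v + 2 * v * 2
    arithmetic = solve-∀

  Gamma⇔ : ∀ i x y → (Gamma t W i x y ≡ true) ⇔ (c x y ≡ 2F ⊎ c x y ≡ i)
  Gamma⇔ i x y = subst (λ b → (b ≡ true) ⇔ (c x y ≡ 2F ⊎ c x y ≡ i)) (sym (Gamma-adjacent i x y)) (∨-≟ (c x y) 2F i)

  inK2₃ : InK2 N (Gamma t W 3F)
  inK2₃ = c , higmanian , inj₁ (Gamma⇔ 3F , c₃₃³≡c₃₃⁴ , K2-valencies n₃ n₄)

  inK2₄ : InK2 N (Gamma t W 4F)
  inK2₄ = c , higmanian , inj₂ (Gamma⇔ 4F , c₃₃³≡c₃₃⁴ , K2-valencies n₄ n₃)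

  class : Fin N → Fin n
  class x = fromℕ< (half< (FinP.toℕ<n x))

  class-size : ∀ a → count N (λ x → ⌊ class x Fin.≟ a ⌋) ≡ 2
  class-size a = begin
    count N (λ x → ⌊ class x Fin.≟ a ⌋)    ≡⟨ count-cong N (λ x → fromℕ<-≟ (half< (FinP.toℕ<n x)) a) ⟩
    count N (λ x → toℕ a ≡ᵇ toℕ x / 2)     ≡⟨ count-∑ N (λ X → toℕ a ≡ᵇ X / 2) ⟩
    ∑[ X < N ] [ toℕ a ≡ᵇ X / 2 ]          ≡⟨ cong (λ m → ∑[ X < m ] [ toℕ a ≡ᵇ X / 2 ]) N≡n*2 ⟩
    ∑[ X < n * 2 ] [ toℕ a ≡ᵇ X / 2 ]      ≡⟨ ∑-block n 2 (FinP.toℕ<n a) ⟩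
    2                                        ∎
    where open ≡-Reasoning

  class≡ : ∀ x y → class x ≡ class y → toℕ x / 2 ≡ toℕ y / 2
  class≡ x y eq = trans (sym (FinP.toℕ-fromℕ< _)) (trans (cong toℕ eq) (FinP.toℕ-fromℕ< _))

  common-colour : ∀ i x y {γ} → c x y ≡ γ → common N (Gamma t W i) x y ≡ ⟦ intersection (bothAdjacent i) γ ⟧ u
  common-colour i x y c≡γ = trans (common-Gamma i x y) (cong (λ γ → ⟦ intersection (bothAdjacent i) γ ⟧ u) c≡γ)

  Gamma-degree : ∀ i → i ≡ 3F ⊎ i ≡ 4F → ∀ x → degree N (Gamma t W i) x ≡ 4 * t + 2
  Gamma-degree i i∈34 x = begin
    degree N (Gamma t W i) x                 ≡⟨ degree≡common N (Gamma t W i) x ⟩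
    common N (Gamma t W i) x x               ≡⟨ common-colour i x x (c-refl x) ⟩
    ⟦ intersection (bothAdjacent i) 0F ⟧ u   ≡⟨ cong (λ p → ⟦ p ⟧ u) (proj₁ (common-fibre i i∈34)) ⟩
    10 + 4 * u                               ≡⟨ arithmetic u ⟩
    4 * (2 + u) + 2                          ∎
    where
    open ≡-Reasoning
    arithmetic : ∀ u → 10 + 4 * u ≡ 4 * (2 + u) + 2
    arithmetic = solve-∀

  Gamma-λ₁ : ∀ i → i ≡ 3F ⊎ i ≡ 4F → ∀ x y → x ≢ y → class x ≡ class y → common N (Gamma t W i) x y ≡ 6
  Gamma-λ₁ i i∈34 x y x≢y class≡class = in-fibre (Equivalence.from (c-fibre x y) (class≡ x y class≡class))
    where
    in-fibre : c x y ≡ 0F ⊎ c x y ≡ 1F → common N (Gamma t W i) x y ≡ 6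
    in-fibre (inj₁ c≡0) = ⊥-elim (x≢y (Equivalence.to (c-diagonal x y) c≡0))
    in-fibre (inj₂ c≡1) = trans (common-colour i x y c≡1) (cong (λ p → ⟦ p ⟧ u) (proj₂ (common-fibre i i∈34)))

  Gamma-λ₂ : ∀ i → i ≡ 3F ⊎ i ≡ 4F → ∀ x y → class x ≢ class y → common N (Gamma t W i) x y ≡ 2 * t + 2
  Gamma-λ₂ i i∈34 x y class≢class = begin
    common N (Gamma t W i) x y                     ≡⟨ common-Gamma i x y ⟩
    ⟦ intersection (bothAdjacent i) (c x y) ⟧ u    ≡⟨ cong (λ p → ⟦ p ⟧ u) (common-offFibre i (c x y) i∈34 c∉01) ⟩
    6 + 2 * u                                      ≡⟨ arithmetic u ⟩
    2 * (2 + u) + 2                                ∎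
    where
    open ≡-Reasoning
    arithmetic : ∀ u → 6 + 2 * u ≡ 2 * (2 + u) + 2
    arithmetic = solve-∀
    c∉01 : ¬ (c x y ≡ 0F ⊎ c x y ≡ 1F)
    c∉01 c∈01 = class≢class (FinP.toℕ-injective (trans (FinP.toℕ-fromℕ< _)
                  (trans (Equivalence.to (c-fibre x y) c∈01) (sym (FinP.toℕ-fromℕ< _)))))

  ddg : ∀ i → i ≡ 3F ⊎ i ≡ 4F → IsDDG N (Gamma t W i) N (4 * t + 2) 6 (2 * t + 2) n 2
  ddg i i∈34 = refl , Gamma-degree i i∈34 , class , class-size , Gamma-λ₁ i i∈34 , Gamma-λ₂ i i∈34

  proper-ddg : ∀ i → i ≡ 3F ⊎ i ≡ 4F → 1 ≤ u → IsProperDDG N (Gamma t W i) N (4 * t + 2) 6 (2 * t + 2) n 2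
  proper-ddg i i∈34 1≤u = ddg i i∈34 , s≤s (s≤s z≤n) , s≤s (s≤s z≤n) , λ 6≡λ₂ → <-irrefl 6≡λ₂ 6<λ₂
    where
    arithmetic : ∀ u → 6 + 2 * u ≡ 2 * (2 + u) + 2
    arithmetic = solve-∀
    6<λ₂ : 6 < 2 * t + 2
    6<λ₂ = subst (6 <_) (arithmetic u) (m<m+n 6 (≤-trans 1≤u (m≤m+n u (u + 0))))

corollary5p4 : (t : ℕ) → 3 ≤ t → (W : FMat (4 * t))
    → IsWeighing (4 * t) (4 * (t ∸ 1)) W → IsSymmetricMat (4 * t) W → ZeroDiag4Blocks (4 * t) W
    → (IsProperDDG (8 * t) (Gamma t W 3F) (8 * t) (4 * t + 2) 6 (2 * t + 2) (4 * t) 2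
        × InK2 (8 * t) (Gamma t W 3F))
      × (IsProperDDG (8 * t) (Gamma t W 4F) (8 * t) (4 * t + 2) 6 (2 * t + 2) (4 * t) 2
        × InK2 (8 * t) (Gamma t W 4F))
corollary5p4 (suc (suc (suc s))) (s≤s (s≤s (s≤s _))) W weighing symmetric zeroBlocks =
  (proper-ddg 3F (inj₁ refl) (s≤s z≤n) , inK2₃) , (proper-ddg 4F (inj₂ refl) (s≤s z≤n) , inK2₄)
  where open Construction (suc s) W weighing symmetric zeroBlocks
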